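{- Let $A\geq a\geq 1$ and $r\geq 2$ be integers. The generating function $\sum_\pi q^{|\pi|}$ over the overpartitions $\pi$ having at least one overlined part whose size is $\equiv a\pmod A$ and less than $\widetilde{mes}_{r,A,a}(\pi)$ is \[\frac{(-q;q)_{\infty }}{(q;q)_{\infty }}\sum_{k=0}^{\infty}\frac{q^{(r-1)[A\binom{k}{2}+ka]+kA+a}}{(-q^{a};q^{A})_{k+1}}.\]
   Context: An overpartition is a partition (finite non-increasing sequence of positive integers) in which the first occurrence of each part value may be overlined; $|\pi|$ is the sum of parts. A part is of size $t$ if it equals $t$ or $\overline{t}$. $(a;q)_\infty=\prod_{i\geq0}(1-aq^i)$, $(a;q)_n=(a;q)_\infty/(aq^n;q)_\infty$; $|q|<1$. For $r\geq2$, $\widetilde{mes}_{r,A,a}(\pi)$ is the smallest positive integer $m\equiv a\pmod A$ such that $\pi$ has no overlined part $\overline{m}$ and $\pi$ has fewer than $r-1$ non-overlined parts equal to $m$. -}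

module Defs where

open import Data.Nat as ℕ using (ℕ; zero; suc; _≤_; _<_; _∸_; _≡ᵇ_; _≤ᵇ_)
open import Data.Nat.Combinatorics using (_C_)
open import Data.Integer as ℤ using (ℤ; +_; -_; 1ℤ; 0ℤ)
open import Data.Integer.Divisibility using () renaming (_∣_ to _∣ℤ_)
open import Data.Bool using (Bool; true; false; if_then_else_; not; _∧_)
open import Data.Product using (Σ; ∃; _×_; _,_; proj₁)
open import Data.Sum using (_⊎_)
open import Data.List using (List; []; _∷_)
open import Data.List.Relation.Unary.All using (All)
open import Data.List.Relation.Unary.Linked using (Linked)
open import Data.List.Membership.Propositional using (_∈_)
open import Relation.Binary.PropositionalEquality using (_≡_)
open import Relation.Nullary using (¬_)

-- A part is (size , overlined?).  An overpartition is represented by the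
-- list of its parts in canonical order: sizes non-increasing, and within
-- a block of equal sizes only the first entry may be overlined (the
-- overlined copy, if any, comes first).  Every overpartition has exactly
-- one such representation.

Part : Set
Part = ℕ × Bool

OrderedParts : Part → Part → Set
OrderedParts (t₁ , b₁) (t₂ , b₂) = (t₂ < t₁) ⊎ ((t₂ ≡ t₁) × (b₂ ≡ false))

IsOverpartition : List Part → Set
IsOverpartition π = All (λ p → 1 ≤ proj₁ p) π × Linked OrderedParts π

weight : List Part → ℕ
weight []             = 0
weight ((t , _) ∷ xs) = t ℕ.+ weight xs

countNon : ℕ → List Part → ℕ
countNon m [] = 0
countNon m ((t , b) ∷ xs) =
  (if not b ∧ (t ≡ᵇ m) then 1 else 0) ℕ.+ countNon m xs

Congr : ℕ → ℕ → ℕ → Set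
Congr A m a = (+ A) ∣ℤ ((+ m) ℤ.- (+ a))

Free : ℕ → List Part → ℕ → Set
Free r π m = ¬ ((m , true) ∈ π) × (countNon m π < r ∸ 1)

IsMes : ℕ → ℕ → ℕ → List Part → ℕ → Set
IsMes r A a π m =
  (1 ≤ m) × Congr A m a × Free r π m ×
  (∀ m′ → 1 ≤ m′ → Congr A m′ a → Free r π m′ → m ≤ m′)

Counted : ℕ → ℕ → ℕ → List Part → Set
Counted r A a π =
  ∃ λ t → ((t , true) ∈ π) × Congr A t a ×
          (∃ λ m → IsMes r A a π m × (t < m))

Series : Set
Series = ℕ → ℤ

sumTo : (ℕ → ℤ) → ℕ → ℤ
sumTo f zero    = f zero
sumTo f (suc n) = sumTo f n ℤ.+ f (suc n)

_⊛_ : Series → Series → Series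
(f ⊛ g) n = sumTo (λ i → f i ℤ.* g (n ∸ i)) n

one : Series
one zero    = 1ℤ
one (suc _) = 0ℤ

prodRange : (ℕ → Series) → ℕ → ℕ → Series
prodRange f lo zero      = one
prodRange f lo (suc len) = f lo ⊛ prodRange f (suc lo) len

ind : Bool → ℤ
ind true  = 1ℤ
ind false = 0ℤ

sign : ℕ → ℤ
sign zero    = 1ℤ
sign (suc j) = - sign j

onePlus : ℕ → Series
onePlus d n = one n ℤ.+ ind (n ≡ᵇ d)

-- 1/(1 - q^d) = Σ_{j≥0} q^{dj}   (used with d ≥ 1)
invOneMinus : ℕ → Series
invOneMinus d n = sumTo (λ j → ind ((d ℕ.* j) ≡ᵇ n)) n

-- 1/(1 + q^d) = Σ_{j≥0} (-1)^j q^{dj}   (used with d ≥ 1)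
invOnePlus : ℕ → Series
invOnePlus d n = sumTo (λ j → sign j ℤ.* ind ((d ℕ.* j) ≡ᵇ n)) n

shift : ℕ → Series → Series
shift e f n = if e ≤ᵇ n then f (n ∸ e) else 0ℤ

-- Infinite product ∏_{i≥1} f i of series with f i ≡ 1 (mod q^i):
-- the coefficient of q^n only depends on the factors with i ≤ n.
prodFrom1 : (ℕ → Series) → Series
prodFrom1 f n = prodRange f 1 n n

minusqInf : Series
minusqInf = prodFrom1 onePlus

invqInf : Series
invqInf = prodFrom1 invOneMinus

invPoch : ℕ → ℕ → ℕ → Series
invPoch A a k = prodRange (λ j → invOnePlus (a ℕ.+ j ℕ.* A)) 0 (suc k)

exponent : ℕ → ℕ → ℕ → ℕ → ℕ
exponent r A a k =
  (r ∸ 1) ℕ.* (A ℕ.* (k C 2) ℕ.+ k ℕ.* a) ℕ.+ k ℕ.* A ℕ.+ a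

term : ℕ → ℕ → ℕ → ℕ → Series
term r A a k = shift (exponent r A a k) (invPoch A a k)

-- Σ_{k≥0} term k ; term k = O(q^{k+1}) (exponent ≥ kA + a ≥ k+1),
-- so the coefficient of q^n only involves k ≤ n.
sumTerms : ℕ → ℕ → ℕ → Series
sumTerms r A a n = sumTo (λ k → term r A a k n) n

rhs : ℕ → ℕ → ℕ → Series
rhs r A a = (minusqInf ⊛ invqInf) ⊛ sumTerms r A a

module Submission where

-- Write m k = a + kA. If π is counted, its least overlined part m k in the progression lies below
-- mes~(π), so every earlier m j (j < k) is non-overlined and occurs at least r − 1 times; conversely,
-- for such a "pivot" k, mes~(π) is the first m j that is neither overlined nor repeated r − 1 times,
-- and it lies beyond m k. The pivot is unique, so the counted overpartitions split by k. For fixed k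
-- the generating function factors over part sizes s: q^s/(1 − q^s) at s = m k, q^{(r−1)s}/(1 − q^s)
-- at an earlier m j, and (1 + q^s)/(1 − q^s) elsewhere. Rewriting the first two as
-- (1 + q^s)/(1 − q^s) · q^s/(1 + q^s) and · q^{(r−1)s}/(1 + q^s) turns the product into
-- (−q;q)_∞/(q;q)_∞ · q^{(r−1)[A·C(k,2) + ka] + kA + a}/(−q^a;q^A)_{k+1}.
-- All coefficients are realised as lengths of duplicate-free lists that enumerate the overpartitions
-- block by block, from the largest part size down.

open import Defs
open import Algebra.Bundles using (CommutativeMonoid)
import Algebra.Properties.CommutativeSemigroup as CommutativeSemigroupProperties
open import Data.Bool using (Bool; true; false; if_then_else_; not; _∧_; _∨_)
import Data.Bool.Properties as BoolP
open import Data.Empty using (⊥-elim)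
open import Data.Integer as ℤ using (ℤ; -_; 0ℤ; 1ℤ; _+_; _*_)
import Data.Integer.Properties as ℤP
open import Data.List using (List; []; _∷_; _++_; map; length; replicate; cartesianProduct)
import Data.List.Properties as ListP
open import Data.List.Membership.Propositional using (_∈_)
open import Data.List.Membership.Propositional.Properties
  using (∈-++⁺ˡ; ∈-++⁺ʳ; ∈-++⁻; ∈-map⁺; ∈-map⁻; ∈-cartesianProduct⁺; ∈-cartesianProduct⁻)
open import Data.List.Relation.Unary.All as All using (All; []; _∷_)
import Data.List.Relation.Unary.All.Properties as AllP
open import Data.List.Relation.Unary.AllPairs using ([]; _∷_)
open import Data.List.Relation.Unary.Any using (here; there)
open import Data.List.Relation.Unary.Linked as Linked using (Linked; []; [-]; _∷_)
open import Data.List.Relation.Unary.Unique.Propositional using (Unique)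
import Data.List.Relation.Unary.Unique.Propositional.Properties as UniqueP
open import Data.Nat as ℕ using (ℕ; zero; suc; _≤_; _<_; _∸_; _≡ᵇ_; _≤ᵇ_; z≤n; s≤s)
open import Data.Nat.Combinatorics using (_C_; nC1≡n; nCk+nC[k+1]≡[n+1]C[k+1])
open import Data.Nat.Divisibility using (divides)
import Data.Nat.Properties as ℕP
open import Data.Nat.Tactic.RingSolver using (solve-∀)
open import Data.Product using (Σ; ∃; _×_; _,_; proj₁; proj₂)
open import Data.Sum using (_⊎_; inj₁; inj₂)
open import Data.Unit using (⊤; tt)
open import Function.Base using (_∘_)
open import Function.Bundles using (Equivalence; _⇔_; mk⇔)
open import Level using (0ℓ)
open import Relation.Binary.Bundles using (Setoid)
open import Relation.Binary.Definitions using (tri<; tri≈; tri>)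
open import Relation.Binary.PropositionalEquality
open import Relation.Nullary using (¬_; Dec; yes; no)

open ≡-Reasoning

sumTo-cong : ∀ {f g} n → (∀ i → i ≤ n → f i ≡ g i) → sumTo f n ≡ sumTo g n
sumTo-cong zero    f≡g = f≡g 0 z≤n
sumTo-cong (suc n) f≡g =
  cong₂ _+_ (sumTo-cong n (λ i i≤n → f≡g i (ℕP.m≤n⇒m≤1+n i≤n))) (f≡g (suc n) ℕP.≤-refl)

sumTo-zero : ∀ {f} n → (∀ i → i ≤ n → f i ≡ 0ℤ) → sumTo f n ≡ 0ℤ
sumTo-zero zero    f≡0 = f≡0 0 z≤n
sumTo-zero (suc n) f≡0 =
  cong₂ _+_ (sumTo-zero n (λ i i≤n → f≡0 i (ℕP.m≤n⇒m≤1+n i≤n))) (f≡0 (suc n) ℕP.≤-refl)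

sumTo-+ : ∀ f g n → sumTo (λ i → f i + g i) n ≡ sumTo f n + sumTo g n
sumTo-+ f g zero    = refl
sumTo-+ f g (suc n) = begin
  sumTo (λ i → f i + g i) n + (f (suc n) + g (suc n))
    ≡⟨ cong (_+ (f (suc n) + g (suc n))) (sumTo-+ f g n) ⟩
  (sumTo f n + sumTo g n) + (f (suc n) + g (suc n))
    ≡⟨ +-interchange (sumTo f n) (sumTo g n) (f (suc n)) (g (suc n)) ⟩
  (sumTo f n + f (suc n)) + (sumTo g n + g (suc n)) ∎
  where open CommutativeSemigroupProperties ℤP.+-commutativeSemigroup renaming (interchange to +-interchange)

sumTo-*ˡ : ∀ c f n → sumTo (λ i → c * f i) n ≡ c * sumTo f n
sumTo-*ˡ c f zero    = refl
sumTo-*ˡ c f (suc n) = trans (cong (_+ c * f (suc n)) (sumTo-*ˡ c f n))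
  (sym (ℤP.*-distribˡ-+ c (sumTo f n) (f (suc n))))

sumTo-*ʳ : ∀ c f n → sumTo (λ i → f i * c) n ≡ sumTo f n * c
sumTo-*ʳ c f zero    = refl
sumTo-*ʳ c f (suc n) = trans (cong (_+ f (suc n) * c) (sumTo-*ʳ c f n))
  (sym (ℤP.*-distribʳ-+ c (sumTo f n) (f (suc n))))

sumTo-neg : ∀ f n → sumTo (λ i → - f i) n ≡ - sumTo f n
sumTo-neg f zero    = refl
sumTo-neg f (suc n) = trans (cong (_+ - f (suc n)) (sumTo-neg f n))
  (sym (ℤP.neg-distrib-+ (sumTo f n) (f (suc n))))

sumTo-sucˡ : ∀ f n → sumTo f (suc n) ≡ f 0 + sumTo (λ i → f (suc i)) n
sumTo-sucˡ f zero    = refl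
sumTo-sucˡ f (suc n) = trans (cong (_+ f (suc (suc n))) (sumTo-sucˡ f n))
  (ℤP.+-assoc (f 0) (sumTo (λ i → f (suc i)) n) (f (suc (suc n))))

sumTo-reverse : ∀ f n → sumTo f n ≡ sumTo (λ i → f (n ∸ i)) n
sumTo-reverse f zero    = refl
sumTo-reverse f (suc n) = begin
  sumTo f (suc n)
    ≡⟨ sumTo-sucˡ f n ⟩
  f 0 + sumTo (λ i → f (suc i)) n
    ≡⟨ cong (f 0 +_) (sumTo-reverse (λ i → f (suc i)) n) ⟩
  f 0 + sumTo (λ i → f (suc (n ∸ i))) n
    ≡⟨ ℤP.+-comm (f 0) _ ⟩
  sumTo (λ i → f (suc (n ∸ i))) n + f 0
    ≡⟨ cong₂ _+_ (sumTo-cong n (λ i i≤n → cong f (sym (ℕP.+-∸-assoc 1 i≤n))))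
                 (cong f (sym (ℕP.n∸n≡0 (suc n)))) ⟩
  sumTo (λ i → f (suc n ∸ i)) (suc n) ∎

sumTo-dropLeadingZeros : ∀ f e n → (∀ i → i < e → f i ≡ 0ℤ) →
  sumTo f (e ℕ.+ n) ≡ sumTo (λ i → f (e ℕ.+ i)) n
sumTo-dropLeadingZeros f zero    n f≡0 = refl
sumTo-dropLeadingZeros f (suc e) n f≡0 = begin
  sumTo f (suc (e ℕ.+ n))
    ≡⟨ sumTo-sucˡ f (e ℕ.+ n) ⟩
  f 0 + sumTo (λ i → f (suc i)) (e ℕ.+ n)
    ≡⟨ cong₂ _+_ (f≡0 0 (s≤s z≤n))
         (sumTo-dropLeadingZeros (λ i → f (suc i)) e n (λ i i<e → f≡0 (suc i) (s≤s i<e))) ⟩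
  0ℤ + sumTo (λ i → f (suc e ℕ.+ i)) n
    ≡⟨ ℤP.+-identityˡ _ ⟩
  sumTo (λ i → f (suc e ℕ.+ i)) n ∎

sumTo-dropTrailingZeros : ∀ f m n → m ≤ n → (∀ i → m < i → f i ≡ 0ℤ) → sumTo f n ≡ sumTo f m
sumTo-dropTrailingZeros f m n m≤n f≡0 =
  trans (cong (sumTo f) (sym (ℕP.m+[n∸m]≡n m≤n))) (go (n ∸ m))
  where
  go : ∀ k → sumTo f (m ℕ.+ k) ≡ sumTo f m
  go zero    = cong (sumTo f) (ℕP.+-identityʳ m)
  go (suc k) = begin
    sumTo f (m ℕ.+ suc k)                  ≡⟨ cong (sumTo f) (ℕP.+-suc m k) ⟩
    sumTo f (m ℕ.+ k) + f (suc (m ℕ.+ k))  ≡⟨ cong₂ _+_ (go k) (f≡0 _ (s≤s (ℕP.m≤m+n m k))) ⟩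
    sumTo f m + 0ℤ                         ≡⟨ ℤP.+-identityʳ _ ⟩
    sumTo f m                              ∎

sumTo-swap : ∀ (F : ℕ → ℕ → ℤ) n m →
  sumTo (λ i → sumTo (F i) m) n ≡ sumTo (λ j → sumTo (λ i → F i j) n) m
sumTo-swap F zero    m = refl
sumTo-swap F (suc n) m = trans (cong (_+ sumTo (F (suc n)) m) (sumTo-swap F n m))
  (sym (sumTo-+ (λ j → sumTo (λ i → F i j) n) (F (suc n)) m))

sumTo-triangle : ∀ (F : ℕ → ℕ → ℤ) n →
  sumTo (λ i → sumTo (F i) i) n ≡ sumTo (λ j → sumTo (λ l → F (j ℕ.+ l) j) (n ∸ j)) n
sumTo-triangle F zero    = refl
sumTo-triangle F (suc n) = begin
  sumTo (λ i → sumTo (F i) i) n + sumTo (F (suc n)) (suc n)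
    ≡⟨ cong (_+ sumTo (F (suc n)) (suc n)) (sumTo-triangle F n) ⟩
  Columns n + (sumTo (F (suc n)) n + F (suc n) (suc n))
    ≡⟨ sym (ℤP.+-assoc (Columns n) _ _) ⟩
  (Columns n + sumTo (F (suc n)) n) + F (suc n) (suc n)
    ≡⟨ cong₂ _+_ (sym (sumTo-+ (λ j → column j (n ∸ j)) (F (suc n)) n))
                 (cong (λ x → F x (suc n)) (sym (ℕP.+-identityʳ (suc n)))) ⟩
  sumTo (λ j → column j (n ∸ j) + F (suc n) j) n + column (suc n) 0
    ≡⟨ cong₂ _+_ (sumTo-cong n extend) (cong (column (suc n)) (sym (ℕP.n∸n≡0 n))) ⟩
  sumTo (λ j → column j (suc n ∸ j)) n + column (suc n) (suc n ∸ suc n) ∎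
  where
  column : ℕ → ℕ → ℤ
  column j = sumTo (λ l → F (j ℕ.+ l) j)
  Columns : ℕ → ℤ
  Columns n = sumTo (λ j → column j (n ∸ j)) n
  extend : ∀ j → j ≤ n → column j (n ∸ j) + F (suc n) j ≡ column j (suc n ∸ j)
  extend j j≤n = begin
    column j (n ∸ j) + F (suc n) j
      ≡⟨ cong (λ x → column j (n ∸ j) + F x j)
           (sym (trans (ℕP.+-suc j (n ∸ j)) (cong suc (ℕP.m+[n∸m]≡n j≤n)))) ⟩
    column j (suc (n ∸ j))
      ≡⟨ cong (column j) (sym (ℕP.+-∸-assoc 1 j≤n)) ⟩
    column j (suc n ∸ j) ∎

Series-setoid : Setoid 0ℓ 0ℓ
Series-setoid = ℕ →-setoid ℤ

open Setoid Series-setoid using (_≈_) renaming (refl to ≈-refl; sym to ≈-sym; trans to ≈-trans)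

⊛-congUpTo : ∀ {f f′ g g′} n → (∀ i → i ≤ n → f i ≡ f′ i) → (∀ i → i ≤ n → g i ≡ g′ i) →
  (f ⊛ g) n ≡ (f′ ⊛ g′) n
⊛-congUpTo n f≡ g≡ = sumTo-cong n (λ i i≤n → cong₂ _*_ (f≡ i i≤n) (g≡ (n ∸ i) (ℕP.m∸n≤m n i)))

⊛-cong : ∀ {f f′ g g′} → f ≈ f′ → g ≈ g′ → f ⊛ g ≈ f′ ⊛ g′
⊛-cong f≈ g≈ n = ⊛-congUpTo n (λ i _ → f≈ i) (λ i _ → g≈ i)

⊛-comm : ∀ f g → f ⊛ g ≈ g ⊛ f
⊛-comm f g n = begin
  sumTo (λ i → f i * g (n ∸ i)) n
    ≡⟨ sumTo-reverse _ n ⟩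
  sumTo (λ i → f (n ∸ i) * g (n ∸ (n ∸ i))) n
    ≡⟨ sumTo-cong n (λ i i≤n → trans (cong (λ x → f (n ∸ i) * g x) (ℕP.m∸[m∸n]≡n i≤n))
                                      (ℤP.*-comm (f (n ∸ i)) (g i))) ⟩
  sumTo (λ i → g i * f (n ∸ i)) n ∎

⊛-assoc : ∀ f g h → (f ⊛ g) ⊛ h ≈ f ⊛ (g ⊛ h)
⊛-assoc f g h n = begin
  sumTo (λ i → sumTo (λ j → f j * g (i ∸ j)) i * h (n ∸ i)) n
    ≡⟨ sumTo-cong n (λ i _ → sym (sumTo-*ʳ (h (n ∸ i)) (λ j → f j * g (i ∸ j)) i)) ⟩
  sumTo (λ i → sumTo (λ j → f j * g (i ∸ j) * h (n ∸ i)) i) n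
    ≡⟨ sumTo-triangle (λ i j → f j * g (i ∸ j) * h (n ∸ i)) n ⟩
  sumTo (λ j → sumTo (λ l → f j * g (j ℕ.+ l ∸ j) * h (n ∸ (j ℕ.+ l))) (n ∸ j)) n
    ≡⟨ sumTo-cong n (λ j _ → trans (sumTo-cong (n ∸ j) (λ l _ → reindex j l))
                                   (sumTo-*ˡ (f j) (λ l → g l * h (n ∸ j ∸ l)) (n ∸ j))) ⟩
  sumTo (λ j → f j * sumTo (λ l → g l * h (n ∸ j ∸ l)) (n ∸ j)) n ∎
  where
  reindex : ∀ j l → f j * g (j ℕ.+ l ∸ j) * h (n ∸ (j ℕ.+ l)) ≡ f j * (g l * h (n ∸ j ∸ l))
  reindex j l = trans (cong₂ (λ x y → f j * g x * h y) (ℕP.m+n∸m≡n j l) (sym (ℕP.∸-+-assoc n j l)))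
                      (ℤP.*-assoc (f j) (g l) (h (n ∸ j ∸ l)))

⊛-identityˡ : ∀ f → one ⊛ f ≈ f
⊛-identityˡ f zero    = ℤP.*-identityˡ (f 0)
⊛-identityˡ f (suc n) = begin
  sumTo (λ i → one i * f (suc n ∸ i)) (suc n)
    ≡⟨ sumTo-sucˡ (λ i → one i * f (suc n ∸ i)) n ⟩
  1ℤ * f (suc n) + sumTo (λ i → 0ℤ * f (n ∸ i)) n
    ≡⟨ cong₂ _+_ (ℤP.*-identityˡ (f (suc n))) (sumTo-zero n (λ _ _ → refl)) ⟩
  f (suc n) + 0ℤ
    ≡⟨ ℤP.+-identityʳ (f (suc n)) ⟩
  f (suc n) ∎

⊛-identityʳ : ∀ f → f ⊛ one ≈ f
⊛-identityʳ f = ≈-trans (⊛-comm f one) (⊛-identityˡ f)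

⊛-commutativeMonoid : CommutativeMonoid 0ℓ 0ℓ
⊛-commutativeMonoid = record
  { Carrier = Series
  ; _≈_ = _≈_
  ; _∙_ = _⊛_
  ; ε = one
  ; isCommutativeMonoid = record
    { isMonoid = record
      { isSemigroup = record
        { isMagma = record { isEquivalence = Setoid.isEquivalence Series-setoid ; ∙-cong = ⊛-cong }
        ; assoc = ⊛-assoc
        }
      ; identity = ⊛-identityˡ , ⊛-identityʳ
      }
    ; comm = ⊛-comm
    }
  }

open CommutativeSemigroupProperties (CommutativeMonoid.commutativeSemigroup ⊛-commutativeMonoid)
  using () renaming (interchange to ⊛-interchange)

infixl 6 _⊕_
_⊕_ : Series → Series → Series
(f ⊕ g) n = f n + g n

⊛-distribʳ-⊕ : ∀ f g h → (f ⊕ g) ⊛ h ≈ (f ⊛ h) ⊕ (g ⊛ h)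
⊛-distribʳ-⊕ f g h n =
  trans (sumTo-cong n (λ i _ → ℤP.*-distribʳ-+ (h (n ∸ i)) (f i) (g i))) (sumTo-+ _ _ n)

≤ᵇ-true : ∀ {e n} → e ≤ n → (e ≤ᵇ n) ≡ true
≤ᵇ-true {e} {n} e≤n with e ≤ᵇ n | ℕP.≤⇒≤ᵇ e≤n
... | true | _ = refl

≤ᵇ-false : ∀ {e n} → n < e → (e ≤ᵇ n) ≡ false
≤ᵇ-false {e} {n} n<e with e ≤ᵇ n | ℕP.≤ᵇ⇒≤ e n
... | false | _     = refl
... | true  | e≤n = ⊥-elim (ℕP.<⇒≱ n<e (e≤n _))

shift-≥ : ∀ e f n → e ≤ n → shift e f n ≡ f (n ∸ e)
shift-≥ e f n e≤n rewrite ≤ᵇ-true e≤n = refl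

shift-< : ∀ e f n → n < e → shift e f n ≡ 0ℤ
shift-< e f n n<e rewrite ≤ᵇ-false n<e = refl

shift-+ : ∀ e f d → shift e f (e ℕ.+ d) ≡ f d
shift-+ e f d = trans (shift-≥ e f (e ℕ.+ d) (ℕP.m≤m+n e d)) (cong f (ℕP.m+n∸m≡n e d))

shift-cong : ∀ e {f g} → f ≈ g → shift e f ≈ shift e g
shift-cong e f≈g n with e ≤ᵇ n
... | true  = f≈g (n ∸ e)
... | false = refl

below-or-offset : ∀ e (P : ℕ → Set) → (∀ n → n < e → P n) → (∀ d → P (e ℕ.+ d)) → ∀ n → P n
below-or-offset e P below offset n with e ℕ.≤? n
... | yes e≤n = subst P (ℕP.m+[n∸m]≡n e≤n) (offset (n ∸ e))
... | no  e≰n = below n (ℕP.≰⇒> e≰n)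

shift-⊛ : ∀ e f g → shift e f ⊛ g ≈ shift e (f ⊛ g)
shift-⊛ e f g = below-or-offset e _ below offset
  where
  below : ∀ n → n < e → (shift e f ⊛ g) n ≡ shift e (f ⊛ g) n
  below n n<e =
    trans (sumTo-zero n (λ i i≤n → cong (_* g (n ∸ i)) (shift-< e f i (ℕP.≤-<-trans i≤n n<e))))
          (sym (shift-< e (f ⊛ g) n n<e))
  offset : ∀ d → (shift e f ⊛ g) (e ℕ.+ d) ≡ shift e (f ⊛ g) (e ℕ.+ d)
  offset d = begin
    sumTo (λ i → shift e f i * g (e ℕ.+ d ∸ i)) (e ℕ.+ d)
      ≡⟨ sumTo-dropLeadingZeros _ e d (λ i i<e → cong (_* g (e ℕ.+ d ∸ i)) (shift-< e f i i<e)) ⟩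
    sumTo (λ i → shift e f (e ℕ.+ i) * g (e ℕ.+ d ∸ (e ℕ.+ i))) d
      ≡⟨ sumTo-cong d (λ i _ → cong₂ _*_ (shift-+ e f i) (cong g (ℕP.[m+n]∸[m+o]≡n∸o e d i))) ⟩
    (f ⊛ g) d
      ≡⟨ sym (shift-+ e (f ⊛ g) d) ⟩
    shift e (f ⊛ g) (e ℕ.+ d) ∎

⊛-shift : ∀ e f g → f ⊛ shift e g ≈ shift e (f ⊛ g)
⊛-shift e f g = ≈-trans (⊛-comm f (shift e g)) (≈-trans (shift-⊛ e g f) (shift-cong e (⊛-comm g f)))

shift-shift : ∀ a b f → shift a (shift b f) ≈ shift (a ℕ.+ b) f
shift-shift a b f = below-or-offset a _ below offset
  where
  below : ∀ n → n < a → shift a (shift b f) n ≡ shift (a ℕ.+ b) f n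
  below n n<a = trans (shift-< a (shift b f) n n<a)
    (sym (shift-< (a ℕ.+ b) f n (ℕP.<-≤-trans n<a (ℕP.m≤m+n a b))))
  inner-below : ∀ d → d < b → shift b f d ≡ shift (a ℕ.+ b) f (a ℕ.+ d)
  inner-below d d<b = trans (shift-< b f d d<b) (sym (shift-< (a ℕ.+ b) f (a ℕ.+ d) (ℕP.+-monoʳ-< a d<b)))
  inner-offset : ∀ d → shift b f (b ℕ.+ d) ≡ shift (a ℕ.+ b) f (a ℕ.+ (b ℕ.+ d))
  inner-offset d = trans (shift-+ b f d)
    (sym (trans (cong (shift (a ℕ.+ b) f) (sym (ℕP.+-assoc a b d))) (shift-+ (a ℕ.+ b) f d)))
  offset : ∀ d → shift a (shift b f) (a ℕ.+ d) ≡ shift (a ℕ.+ b) f (a ℕ.+ d)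
  offset d = trans (shift-+ a (shift b f) d) (below-or-offset b _ inner-below inner-offset d)

≡ᵇ-true : ∀ {x y} → x ≡ y → (x ≡ᵇ y) ≡ true
≡ᵇ-true {x} {y} x≡y = Equivalence.to BoolP.T-≡ (ℕP.≡⇒≡ᵇ x y x≡y)

≡ᵇ-sound : ∀ {x y} → (x ≡ᵇ y) ≡ true → x ≡ y
≡ᵇ-sound {x} {y} eq = ℕP.≡ᵇ⇒≡ x y (Equivalence.from BoolP.T-≡ eq)

≡ᵇ-false : ∀ {x y} → x ≢ y → (x ≡ᵇ y) ≡ false
≡ᵇ-false x≢y = BoolP.¬-not (λ eq → x≢y (≡ᵇ-sound eq))

+-≡ᵇ-cancelˡ : ∀ d x e → (d ℕ.+ x ≡ᵇ d ℕ.+ e) ≡ (x ≡ᵇ e)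
+-≡ᵇ-cancelˡ zero    x e = refl
+-≡ᵇ-cancelˡ (suc d) x e = +-≡ᵇ-cancelˡ d x e

ind-≡ᵇ0 : ∀ n → ind (n ≡ᵇ 0) ≡ one n
ind-≡ᵇ0 zero    = refl
ind-≡ᵇ0 (suc n) = refl

geometric : (ℕ → ℤ) → ℕ → Series
geometric c d n = sumTo (λ j → c j * ind (d ℕ.* j ≡ᵇ n)) n

geometric-< : ∀ c d n → n < d → geometric c d n ≡ c 0 * one n
geometric-< c d zero    _   = cong (λ x → c 0 * ind (x ≡ᵇ 0)) (ℕP.*-zeroʳ d)
geometric-< c d (suc n) n<d = begin
  geometric c d (suc n)
    ≡⟨ sumTo-sucˡ (λ j → c j * ind (d ℕ.* j ≡ᵇ suc n)) n ⟩
  c 0 * ind (d ℕ.* 0 ≡ᵇ suc n) + sumTo (λ j → c (suc j) * ind (d ℕ.* suc j ≡ᵇ suc n)) n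
    ≡⟨ cong₂ _+_ (trans (cong (λ x → c 0 * ind (x ≡ᵇ suc n)) (ℕP.*-zeroʳ d)) (ℤP.*-zeroʳ (c 0)))
                 (sumTo-zero n (λ j _ → trans (cong (λ b → c (suc j) * ind b) (≡ᵇ-false (too-big j)))
                                              (ℤP.*-zeroʳ (c (suc j))))) ⟩
  0ℤ + 0ℤ
    ≡⟨ sym (ℤP.*-zeroʳ (c 0)) ⟩
  c 0 * 0ℤ ∎
  where
  too-big : ∀ j → d ℕ.* suc j ≢ suc n
  too-big j eq = ℕP.<⇒≱ n<d (subst (d ≤_) eq (ℕP.m≤m*n d (suc j)))

geometric-+ : ∀ c d e → 1 ≤ d → geometric c d (d ℕ.+ e) ≡ geometric (λ j → c (suc j)) d e
geometric-+ c d@(suc d′) e _ = begin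
  geometric c d (suc (d′ ℕ.+ e))
    ≡⟨ sumTo-sucˡ (λ j → c j * ind (d ℕ.* j ≡ᵇ d ℕ.+ e)) (d′ ℕ.+ e) ⟩
  c 0 * ind (d ℕ.* 0 ≡ᵇ d ℕ.+ e) + sumTo (λ j → c (suc j) * ind (d ℕ.* suc j ≡ᵇ d ℕ.+ e)) (d′ ℕ.+ e)
    ≡⟨ cong₂ _+_ (trans (cong (λ x → c 0 * ind (x ≡ᵇ d ℕ.+ e)) (ℕP.*-zeroʳ d)) (ℤP.*-zeroʳ (c 0)))
                 (sumTo-cong (d′ ℕ.+ e) (λ j _ → cong (λ b → c (suc j) * ind b)
                    (trans (cong (_≡ᵇ d ℕ.+ e) (ℕP.*-suc d j)) (+-≡ᵇ-cancelˡ d (d ℕ.* j) e)))) ⟩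
  0ℤ + sumTo (λ j → c (suc j) * ind (d ℕ.* j ≡ᵇ e)) (d′ ℕ.+ e)
    ≡⟨ ℤP.+-identityˡ _ ⟩
  sumTo (λ j → c (suc j) * ind (d ℕ.* j ≡ᵇ e)) (d′ ℕ.+ e)
    ≡⟨ sumTo-dropTrailingZeros _ e (d′ ℕ.+ e) (ℕP.m≤n+m e d′) (λ j e<j →
         trans (cong (λ b → c (suc j) * ind b)
                     (≡ᵇ-false (λ eq → ℕP.<⇒≱ e<j (subst (j ≤_) eq (ℕP.m≤n*m j d)))))
               (ℤP.*-zeroʳ (c (suc j)))) ⟩
  geometric (λ j → c (suc j)) d e ∎

invOneMinus≈geometric : ∀ d → invOneMinus d ≈ geometric (λ _ → 1ℤ) d
invOneMinus≈geometric d n = sumTo-cong n (λ j _ → sym (ℤP.*-identityˡ _))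

ind-≡ᵇ≈shift-one : ∀ d → (λ n → ind (n ≡ᵇ d)) ≈ shift d one
ind-≡ᵇ≈shift-one d = below-or-offset d _ below offset
  where
  below : ∀ n → n < d → ind (n ≡ᵇ d) ≡ shift d one n
  below n n<d = trans (cong ind (≡ᵇ-false (ℕP.<⇒≢ n<d))) (sym (shift-< d one n n<d))
  offset : ∀ e → ind (d ℕ.+ e ≡ᵇ d) ≡ shift d one (d ℕ.+ e)
  offset e = begin
    ind (d ℕ.+ e ≡ᵇ d)          ≡⟨ cong (λ x → ind (d ℕ.+ e ≡ᵇ x)) (sym (ℕP.+-identityʳ d)) ⟩
    ind (d ℕ.+ e ≡ᵇ d ℕ.+ 0)    ≡⟨ cong ind (+-≡ᵇ-cancelˡ d e 0) ⟩
    ind (e ≡ᵇ 0)                ≡⟨ ind-≡ᵇ0 e ⟩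
    one e                       ≡⟨ sym (shift-+ d one e) ⟩
    shift d one (d ℕ.+ e)       ∎

-- (1 + q^d) · Σ (−1)ʲ q^{dj} telescopes: the shift by d cancels every term but the constant one.
invOnePlus-recurrence : ∀ d → 1 ≤ d → invOnePlus d ⊕ shift d (invOnePlus d) ≈ one
invOnePlus-recurrence d@(suc _) 1≤d = below-or-offset d _ below offset
  where
  below : ∀ n → n < d → invOnePlus d n + shift d (invOnePlus d) n ≡ one n
  below n n<d = trans (cong₂ _+_ (geometric-< sign d n n<d) (shift-< d (invOnePlus d) n n<d))
                      (trans (ℤP.+-identityʳ _) (ℤP.*-identityˡ (one n)))
  offset : ∀ e → invOnePlus d (d ℕ.+ e) + shift d (invOnePlus d) (d ℕ.+ e) ≡ one (d ℕ.+ e)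
  offset e = begin
    invOnePlus d (d ℕ.+ e) + shift d (invOnePlus d) (d ℕ.+ e)
      ≡⟨ cong₂ _+_ (geometric-+ sign d e 1≤d) (shift-+ d (invOnePlus d) e) ⟩
    geometric (λ j → - sign j) d e + invOnePlus d e
      ≡⟨ cong (_+ invOnePlus d e)
           (trans (sumTo-cong e (λ j _ → sym (ℤP.neg-distribˡ-* (sign j) _)))
                  (sumTo-neg (λ j → sign j * ind (d ℕ.* j ≡ᵇ e)) e)) ⟩
    - invOnePlus d e + invOnePlus d e
      ≡⟨ ℤP.+-inverseˡ (invOnePlus d e) ⟩
    one (d ℕ.+ e) ∎

onePlus⊛invOnePlus : ∀ d → 1 ≤ d → onePlus d ⊛ invOnePlus d ≈ one
onePlus⊛invOnePlus d 1≤d n = begin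
  (onePlus d ⊛ invOnePlus d) n
    ≡⟨ ⊛-cong {g = invOnePlus d} (λ i → cong (one i +_) (ind-≡ᵇ≈shift-one d i)) ≈-refl n ⟩
  ((one ⊕ shift d one) ⊛ invOnePlus d) n
    ≡⟨ ⊛-distribʳ-⊕ one (shift d one) (invOnePlus d) n ⟩
  (one ⊛ invOnePlus d) n + (shift d one ⊛ invOnePlus d) n
    ≡⟨ cong₂ _+_ (⊛-identityˡ (invOnePlus d) n)
                 (trans (shift-⊛ d one (invOnePlus d) n) (shift-cong d (⊛-identityˡ (invOnePlus d)) n)) ⟩
  invOnePlus d n + shift d (invOnePlus d) n
    ≡⟨ invOnePlus-recurrence d 1≤d n ⟩
  one n ∎

OneBelow : ℕ → Series → Set
OneBelow d f = ∀ i → i < d → f i ≡ one i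

⊛-oneBelowʳ : ∀ {d g} → OneBelow d g → ∀ f i → i < d → (f ⊛ g) i ≡ f i
⊛-oneBelowʳ {d} {g} g≡1 f i i<d =
  trans (⊛-congUpTo {f} {f} {g} {one} i (λ _ _ → refl) (λ j j≤i → g≡1 j (ℕP.≤-<-trans j≤i i<d)))
        (⊛-identityʳ f i)

onePlus-oneBelow : ∀ s → OneBelow s (onePlus s)
onePlus-oneBelow s i i<s =
  trans (cong (λ b → one i + ind b) (≡ᵇ-false (ℕP.<⇒≢ i<s))) (ℤP.+-identityʳ (one i))

invOneMinus-oneBelow : ∀ s → OneBelow s (invOneMinus s)
invOneMinus-oneBelow s i i<s =
  trans (invOneMinus≈geometric s i) (trans (geometric-< (λ _ → 1ℤ) s i i<s) (ℤP.*-identityˡ (one i)))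

prodRange-snoc : ∀ f lo len → prodRange f lo (suc len) ≈ prodRange f lo len ⊛ f (lo ℕ.+ len)
prodRange-snoc f lo zero      n = begin
  (f lo ⊛ one) n        ≡⟨ ⊛-identityʳ (f lo) n ⟩
  f lo n                ≡⟨ cong (λ x → f x n) (sym (ℕP.+-identityʳ lo)) ⟩
  f (lo ℕ.+ 0) n        ≡⟨ ⊛-identityˡ (f (lo ℕ.+ 0)) n ⟨
  (one ⊛ f (lo ℕ.+ 0)) n ∎
prodRange-snoc f lo (suc len) n = begin
  (f lo ⊛ prodRange f (suc lo) (suc len)) n
    ≡⟨ ⊛-cong {f lo} ≈-refl (prodRange-snoc f (suc lo) len) n ⟩
  (f lo ⊛ (prodRange f (suc lo) len ⊛ f (suc lo ℕ.+ len))) n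
    ≡⟨ ⊛-assoc (f lo) (prodRange f (suc lo) len) (f (suc lo ℕ.+ len)) n ⟨
  ((f lo ⊛ prodRange f (suc lo) len) ⊛ f (suc lo ℕ.+ len)) n
    ≡⟨ cong (λ x → ((f lo ⊛ prodRange f (suc lo) len) ⊛ f x) n) (sym (ℕP.+-suc lo len)) ⟩
  ((f lo ⊛ prodRange f (suc lo) len) ⊛ f (lo ℕ.+ suc len)) n ∎

prodRange-stable : ∀ f → (∀ s → OneBelow s (f s)) → ∀ len i → i ≤ len →
  prodRange f 1 len i ≡ prodFrom1 f i
prodRange-stable f f≡1 len i i≤len with ℕP.m≤n⇒m<n∨m≡n i≤len
... | inj₂ refl = refl
prodRange-stable f f≡1 (suc len) i _ | inj₁ (s≤s i≤len) = begin
  prodRange f 1 (suc len) i          ≡⟨ prodRange-snoc f 1 len i ⟩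
  (prodRange f 1 len ⊛ f (suc len)) i ≡⟨ ⊛-oneBelowʳ (f≡1 (suc len)) (prodRange f 1 len) i (s≤s i≤len) ⟩
  prodRange f 1 len i                ≡⟨ prodRange-stable f f≡1 len i i≤len ⟩
  prodFrom1 f i                      ∎

prodDown : (ℕ → Series) → ℕ → Series
prodDown F zero    = one
prodDown F (suc t) = F (suc t) ⊛ prodDown F t

prodRange≈prodDown : ∀ F t → prodRange F 1 t ≈ prodDown F t
prodRange≈prodDown F zero    = ≈-refl
prodRange≈prodDown F (suc t) n = begin
  prodRange F 1 (suc t) n          ≡⟨ prodRange-snoc F 1 t n ⟩
  (prodRange F 1 t ⊛ F (suc t)) n   ≡⟨ ⊛-cong {g = F (suc t)} (prodRange≈prodDown F t) ≈-refl n ⟩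
  (prodDown F t ⊛ F (suc t)) n      ≡⟨ ⊛-comm (prodDown F t) (F (suc t)) n ⟩
  prodDown F (suc t) n              ∎

prodFrom1≈prodDown : ∀ f → (∀ s → OneBelow s (f s)) → ∀ t i → i ≤ t → prodFrom1 f i ≡ prodDown f t i
prodFrom1≈prodDown f f≡1 t i i≤t = trans (sym (prodRange-stable f f≡1 t i i≤t)) (prodRange≈prodDown f t i)

prodDown-cong : ∀ {F G} t → (∀ s → 1 ≤ s → s ≤ t → F s ≈ G s) → prodDown F t ≈ prodDown G t
prodDown-cong zero    F≈G = ≈-refl
prodDown-cong (suc t) F≈G =
  ⊛-cong (F≈G (suc t) (s≤s z≤n) ℕP.≤-refl)
         (prodDown-cong t (λ s 1≤s s≤t → F≈G s 1≤s (ℕP.m≤n⇒m≤1+n s≤t)))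

prodDown-⊛ : ∀ F G t → prodDown (λ s → F s ⊛ G s) t ≈ prodDown F t ⊛ prodDown G t
prodDown-⊛ F G zero    = ≈-sym (⊛-identityˡ one)
prodDown-⊛ F G (suc t) = ≈-trans (⊛-cong {F (suc t) ⊛ G (suc t)} ≈-refl (prodDown-⊛ F G t))
  (⊛-interchange (F (suc t)) (G (suc t)) (prodDown F t) (prodDown G t))

prodDown-one : ∀ t → prodDown (λ _ → one) t ≈ one
prodDown-one zero    = ≈-refl
prodDown-one (suc t) =
  ≈-trans {prodDown (λ _ → one) (suc t)} (⊛-identityˡ (prodDown (λ _ → one) t)) (prodDown-one t)

sumDown : (ℕ → ℕ) → ℕ → ℕ
sumDown δ zero    = 0
sumDown δ (suc t) = δ (suc t) ℕ.+ sumDown δ t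

prodDown-shift : ∀ δ X t → prodDown (λ s → shift (δ s) (X s)) t ≈ shift (sumDown δ t) (prodDown X t)
prodDown-shift δ X zero    = ≈-refl
prodDown-shift δ X (suc t) n = begin
  (shift (δ (suc t)) (X (suc t)) ⊛ prodDown (λ s → shift (δ s) (X s)) t) n
    ≡⟨ ⊛-cong {shift (δ (suc t)) (X (suc t))} ≈-refl (prodDown-shift δ X t) n ⟩
  (shift (δ (suc t)) (X (suc t)) ⊛ shift (sumDown δ t) (prodDown X t)) n
    ≡⟨ shift-⊛ (δ (suc t)) (X (suc t)) (shift (sumDown δ t) (prodDown X t)) n ⟩
  shift (δ (suc t)) (X (suc t) ⊛ shift (sumDown δ t) (prodDown X t)) n
    ≡⟨ shift-cong (δ (suc t)) (⊛-shift (sumDown δ t) (X (suc t)) (prodDown X t)) n ⟩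
  shift (δ (suc t)) (shift (sumDown δ t) (prodDown X (suc t))) n
    ≡⟨ shift-shift (δ (suc t)) (sumDown δ t) (prodDown X (suc t)) n ⟩
  shift (sumDown δ (suc t)) (prodDown X (suc t)) n ∎

prodDown-pointOutside : ∀ X m t → t < m → prodDown (λ s → if s ≡ᵇ m then X else one) t ≈ one
prodDown-pointOutside X m zero    _   = ≈-refl
prodDown-pointOutside X m (suc t) t<m rewrite ≡ᵇ-false (ℕP.<⇒≢ t<m) =
  ≈-trans (⊛-identityˡ _) (prodDown-pointOutside X m t (ℕP.<-trans (ℕP.n<1+n t) t<m))

prodDown-point : ∀ X m t → 1 ≤ m → m ≤ t → prodDown (λ s → if s ≡ᵇ m then X else one) t ≈ X
prodDown-point X m zero 1≤m m≤0 = ⊥-elim (ℕP.<⇒≱ 1≤m m≤0)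
prodDown-point X m (suc t) 1≤m m≤t with ℕP.m≤n⇒m<n∨m≡n m≤t
... | inj₂ refl rewrite ≡ᵇ-true (refl {x = suc t}) =
  ≈-trans (⊛-cong {X} ≈-refl (prodDown-pointOutside X (suc t) t (ℕP.n<1+n t))) (⊛-identityʳ X)
... | inj₁ (s≤s m≤t′) rewrite ≡ᵇ-false (ℕP.<⇒≢ (s≤s m≤t′) ∘ sym) =
  ≈-trans (⊛-identityˡ _) (prodDown-point X m t 1≤m m≤t′)

sumDown-pointOutside : ∀ v m t → t < m → sumDown (λ s → if s ≡ᵇ m then v else 0) t ≡ 0
sumDown-pointOutside v m zero    _   = refl
sumDown-pointOutside v m (suc t) t<m rewrite ≡ᵇ-false (ℕP.<⇒≢ t<m) =
  sumDown-pointOutside v m t (ℕP.<-trans (ℕP.n<1+n t) t<m)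

sumDown-point : ∀ v m t → 1 ≤ m → m ≤ t → sumDown (λ s → if s ≡ᵇ m then v else 0) t ≡ v
sumDown-point v m zero 1≤m m≤0 = ⊥-elim (ℕP.<⇒≱ 1≤m m≤0)
sumDown-point v m (suc t) 1≤m m≤t with ℕP.m≤n⇒m<n∨m≡n m≤t
... | inj₂ refl rewrite ≡ᵇ-true (refl {x = suc t}) =
  trans (cong (v ℕ.+_) (sumDown-pointOutside v (suc t) t (ℕP.n<1+n t))) (ℕP.+-identityʳ v)
... | inj₁ (s≤s m≤t′) rewrite ≡ᵇ-false (ℕP.<⇒≢ (s≤s m≤t′) ∘ sym) =
  sumDown-point v m t 1≤m m≤t′

sumDown-+ : ∀ f g t → sumDown (λ s → f s ℕ.+ g s) t ≡ sumDown f t ℕ.+ sumDown g t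
sumDown-+ f g zero    = refl
sumDown-+ f g (suc t) = trans (cong (f (suc t) ℕ.+ g (suc t) ℕ.+_) (sumDown-+ f g t))
  (ℕ-+-interchange (f (suc t)) (g (suc t)) (sumDown f t) (sumDown g t))
  where open CommutativeSemigroupProperties ℕP.+-commutativeSemigroup renaming (interchange to ℕ-+-interchange)

sumDown-cong : ∀ {f g} t → (∀ s → 1 ≤ s → s ≤ t → f s ≡ g s) → sumDown f t ≡ sumDown g t
sumDown-cong zero    f≡g = refl
sumDown-cong (suc t) f≡g =
  cong₂ ℕ._+_ (f≡g (suc t) (s≤s z≤n) ℕP.≤-refl)
              (sumDown-cong t (λ s 1≤s s≤t → f≡g s 1≤s (ℕP.m≤n⇒m≤1+n s≤t)))

sumDown-zero : ∀ t → sumDown (λ _ → 0) t ≡ 0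
sumDown-zero zero    = refl
sumDown-zero (suc t) = sumDown-zero t

-- Weight-indexed families of lists, counted by series coefficients

private variable
  X Y : Set

lengthℤ : List X → ℤ
lengthℤ xs = ℤ.+ length xs

lengthℤ-++ : ∀ (xs ys : List X) → lengthℤ (xs ++ ys) ≡ lengthℤ xs + lengthℤ ys
lengthℤ-++ xs ys = trans (cong ℤ.+_ (ListP.length-++ xs)) (ℤP.pos-+ (length xs) (length ys))

Graded : (ℕ → List X) → Set
Graded f = ∀ {i j x} → x ∈ f i → x ∈ f j → i ≡ j

concatUpTo : (ℕ → List X) → ℕ → List X
concatUpTo f zero    = f zero
concatUpTo f (suc n) = concatUpTo f n ++ f (suc n)

concatUpTo-length : ∀ (f : ℕ → List X) n → lengthℤ (concatUpTo f n) ≡ sumTo (λ i → lengthℤ (f i)) n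
concatUpTo-length f zero    = refl
concatUpTo-length f (suc n) =
  trans (lengthℤ-++ (concatUpTo f n) (f (suc n))) (cong (_+ lengthℤ (f (suc n))) (concatUpTo-length f n))

∈-concatUpTo⁺ : ∀ (f : ℕ → List X) {x} n i → i ≤ n → x ∈ f i → x ∈ concatUpTo f n
∈-concatUpTo⁺ f zero    .zero z≤n x∈ = x∈
∈-concatUpTo⁺ f (suc n) i i≤n x∈ with ℕP.m≤n⇒m<n∨m≡n i≤n
... | inj₂ refl       = ∈-++⁺ʳ (concatUpTo f n) x∈
... | inj₁ (s≤s i≤n′) = ∈-++⁺ˡ (∈-concatUpTo⁺ f n i i≤n′ x∈)

∈-concatUpTo⁻ : ∀ (f : ℕ → List X) {x} n → x ∈ concatUpTo f n → ∃ λ i → i ≤ n × x ∈ f i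
∈-concatUpTo⁻ f zero    x∈ = 0 , z≤n , x∈
∈-concatUpTo⁻ f (suc n) x∈ with ∈-++⁻ (concatUpTo f n) x∈
... | inj₂ x∈f = suc n , ℕP.≤-refl , x∈f
... | inj₁ x∈c with ∈-concatUpTo⁻ f n x∈c
...   | i , i≤n , x∈f = i , ℕP.m≤n⇒m≤1+n i≤n , x∈f

concatUpTo-unique : ∀ (f : ℕ → List X) n → (∀ i → Unique (f i)) → Graded f → Unique (concatUpTo f n)
concatUpTo-unique f zero    f-unique graded = f-unique 0
concatUpTo-unique f (suc n) f-unique graded =
  UniqueP.++⁺ (concatUpTo-unique f n f-unique graded) (f-unique (suc n)) disjoint
  where
  disjoint : ∀ {x} → ¬ (x ∈ concatUpTo f n × x ∈ f (suc n))
  disjoint (x∈c , x∈f) with ∈-concatUpTo⁻ f n x∈c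
  ... | i , i≤n , x∈fi = ℕP.<⇒≢ (s≤s i≤n) (graded x∈fi x∈f)

length-cartesianProduct : ∀ (xs : List X) (ys : List Y) →
  length (cartesianProduct xs ys) ≡ length xs ℕ.* length ys
length-cartesianProduct []       ys = refl
length-cartesianProduct (x ∷ xs) ys = trans (ListP.length-++ (map (x ,_) ys))
  (cong₂ ℕ._+_ (ListP.length-map (x ,_) ys) (length-cartesianProduct xs ys))

convolveL : (ℕ → List X) → (ℕ → List Y) → ℕ → List (X × Y)
convolveL f g n = concatUpTo (λ i → cartesianProduct (f i) (g (n ∸ i))) n

convolveL-length : ∀ (f : ℕ → List X) (g : ℕ → List Y) n →
  lengthℤ (convolveL f g n) ≡ ((λ i → lengthℤ (f i)) ⊛ (λ j → lengthℤ (g j))) n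
convolveL-length f g n = trans (concatUpTo-length _ n) (sumTo-cong n (λ i _ →
  trans (cong ℤ.+_ (length-cartesianProduct (f i) (g (n ∸ i)))) (ℤP.pos-* (length (f i)) (length (g (n ∸ i))))))

∈-convolveL⁺ : ∀ (f : ℕ → List X) (g : ℕ → List Y) {x y} n i → i ≤ n → x ∈ f i → y ∈ g (n ∸ i) →
  (x , y) ∈ convolveL f g n
∈-convolveL⁺ f g n i i≤n x∈ y∈ = ∈-concatUpTo⁺ _ n i i≤n (∈-cartesianProduct⁺ x∈ y∈)

∈-convolveL⁻ : ∀ (f : ℕ → List X) (g : ℕ → List Y) {x y} n → (x , y) ∈ convolveL f g n →
  ∃ λ i → i ≤ n × x ∈ f i × y ∈ g (n ∸ i)
∈-convolveL⁻ f g n xy∈ with ∈-concatUpTo⁻ _ n xy∈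
... | i , i≤n , xy∈fg with ∈-cartesianProduct⁻ (f i) (g (n ∸ i)) xy∈fg
...   | x∈ , y∈ = i , i≤n , x∈ , y∈

convolveL-unique : ∀ (f : ℕ → List X) (g : ℕ → List Y) n → (∀ i → Unique (f i)) → (∀ j → Unique (g j)) →
  Graded f → Unique (convolveL f g n)
convolveL-unique f g n f-unique g-unique graded =
  concatUpTo-unique _ n (λ i → UniqueP.cartesianProduct⁺ (f-unique i) (g-unique (n ∸ i))) graded-pairs
  where
  graded-pairs : Graded (λ i → cartesianProduct (f i) (g (n ∸ i)))
  graded-pairs {i} {j} p q =
    graded (proj₁ (∈-cartesianProduct⁻ (f i) _ p)) (proj₁ (∈-cartesianProduct⁻ (f j) _ q))

shiftL : ℕ → (ℕ → List X) → ℕ → List X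
shiftL e f n = if e ≤ᵇ n then f (n ∸ e) else []

shiftL-length : ∀ e (f : ℕ → List X) n → lengthℤ (shiftL e f n) ≡ shift e (λ i → lengthℤ (f i)) n
shiftL-length e f n with e ≤ᵇ n
... | true  = refl
... | false = refl

∈-shiftL⁺ : ∀ e (f : ℕ → List X) n {x} → e ≤ n → x ∈ f (n ∸ e) → x ∈ shiftL e f n
∈-shiftL⁺ e f n e≤n x∈ rewrite ≤ᵇ-true e≤n = x∈

∈-shiftL⁻ : ∀ e (f : ℕ → List X) n {x} → x ∈ shiftL e f n → e ≤ n × x ∈ f (n ∸ e)
∈-shiftL⁻ e f n x∈ with e ≤ᵇ n in eq
... | true = ℕP.≤ᵇ⇒≤ e n (Equivalence.from BoolP.T-≡ eq) , x∈

shiftL-unique : ∀ e (f : ℕ → List X) n → (∀ i → Unique (f i)) → Unique (shiftL e f n)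
shiftL-unique e f n f-unique with e ≤ᵇ n
... | true  = f-unique (n ∸ e)
... | false = []

singletonIf : Bool → X → List X
singletonIf true  x = x ∷ []
singletonIf false x = []

singletonIf-length : ∀ b (x : X) → lengthℤ (singletonIf b x) ≡ ind b
singletonIf-length true  x = refl
singletonIf-length false x = refl

∈-singletonIf⁻ : ∀ b (x : X) {y} → y ∈ singletonIf b x → b ≡ true × y ≡ x
∈-singletonIf⁻ true x (here y≡x) = refl , y≡x

singletonIf-unique : ∀ b (x : X) → Unique (singletonIf b x)
singletonIf-unique true  x = [] ∷ []
singletonIf-unique false x = []

map⁺-injectiveOn : ∀ (f : X → Y) {xs} → Unique xs → (∀ {x y} → x ∈ xs → y ∈ xs → f x ≡ f y → x ≡ y) →
  Unique (map f xs)
map⁺-injectiveOn f {[]}     []              inj = []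
map⁺-injectiveOn f {x ∷ xs} (x∉xs ∷ unique) inj =
  AllP.map⁺ (All.tabulate (λ y∈ fx≡fy → All.lookup x∉xs y∈ (inj (here refl) (there y∈) fx≡fy))) ∷
  map⁺-injectiveOn f unique (λ p q → inj (there p) (there q))

-- Overpartitions as sequences of blocks of equal parts

block : ℕ → Bool → ℕ → List Part
block S true  c = (S , true) ∷ replicate c (S , false)
block S false c = replicate c (S , false)

blockWeight : ℕ → Bool → ℕ → ℕ
blockWeight S b c = (if b then S else 0) ℕ.+ S ℕ.* c

hasOverlined : ℕ → List Part → Bool
hasOverlined s []             = false
hasOverlined s ((t , b) ∷ xs) = (b ∧ (t ≡ᵇ s)) ∨ hasOverlined s xs

PartsBelow : ℕ → List Part → Set
PartsBelow S = All (λ p → proj₁ p < S)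

PartsAtMost : ℕ → List Part → Set
PartsAtMost S = All (λ p → proj₁ p ≤ S)

weight-++ : ∀ xs ys → weight (xs ++ ys) ≡ weight xs ℕ.+ weight ys
weight-++ []             ys = refl
weight-++ ((t , b) ∷ xs) ys = trans (cong (t ℕ.+_) (weight-++ xs ys)) (sym (ℕP.+-assoc t (weight xs) (weight ys)))

weight-replicate : ∀ S c → weight (replicate c (S , false)) ≡ S ℕ.* c
weight-replicate S zero    = sym (ℕP.*-zeroʳ S)
weight-replicate S (suc c) = trans (cong (S ℕ.+_) (weight-replicate S c)) (sym (ℕP.*-suc S c))

weight-block : ∀ S b c π → weight (block S b c ++ π) ≡ blockWeight S b c ℕ.+ weight π
weight-block S true  c π = trans (cong (S ℕ.+_) (trans (weight-++ (replicate c (S , false)) π)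
  (cong (ℕ._+ weight π) (weight-replicate S c)))) (sym (ℕP.+-assoc S (S ℕ.* c) (weight π)))
weight-block S false c π = trans (weight-++ (replicate c (S , false)) π) (cong (ℕ._+ weight π) (weight-replicate S c))

∈⇒≤weight : ∀ {t b} π → (t , b) ∈ π → t ≤ weight π
∈⇒≤weight ((t , b) ∷ xs)   (here refl) = ℕP.m≤m+n t (weight xs)
∈⇒≤weight ((t′ , b′) ∷ xs) (there p)   = ℕP.≤-trans (∈⇒≤weight xs p) (ℕP.m≤n+m (weight xs) t′)

partsAtMost-weight : ∀ π → PartsAtMost (weight π) π
partsAtMost-weight π = All.tabulate (∈⇒≤weight π)

hasOverlined-∈⁺ : ∀ s π → (s , true) ∈ π → hasOverlined s π ≡ true
hasOverlined-∈⁺ s ((.s , .true) ∷ xs) (here refl) rewrite ≡ᵇ-true (refl {x = s}) = refl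
hasOverlined-∈⁺ s ((t , b) ∷ xs)      (there p)   rewrite hasOverlined-∈⁺ s xs p =
  BoolP.∨-zeroʳ (b ∧ (t ≡ᵇ s))

hasOverlined-∈⁻ : ∀ s π → hasOverlined s π ≡ true → (s , true) ∈ π
hasOverlined-∈⁻ s ((t , b) ∷ xs) eq with b ∧ (t ≡ᵇ s) in eq′
hasOverlined-∈⁻ s ((t , true)  ∷ xs) eq | true rewrite ≡ᵇ-sound {t} {s} eq′ = here refl
hasOverlined-∈⁻ s ((t , b)     ∷ xs) eq | false = there (hasOverlined-∈⁻ s xs eq)

hasOverlined-absent : ∀ s π → All (λ p → proj₁ p ≢ s) π → hasOverlined s π ≡ false
hasOverlined-absent s []             _        = refl
hasOverlined-absent s ((t , b) ∷ xs) (t≢s ∷ ps) rewrite ≡ᵇ-false t≢s | BoolP.∧-zeroʳ b =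
  hasOverlined-absent s xs ps

countNon-absent : ∀ s π → All (λ p → proj₁ p ≢ s) π → countNon s π ≡ 0
countNon-absent s []             _          = refl
countNon-absent s ((t , b) ∷ xs) (t≢s ∷ ps) rewrite ≡ᵇ-false t≢s | BoolP.∧-zeroʳ (not b) =
  countNon-absent s xs ps

partsBelow⇒≢ : ∀ {S π} → PartsBelow S π → All (λ p → proj₁ p ≢ S) π
partsBelow⇒≢ = All.map ℕP.<⇒≢

hasOverlined-replicate : ∀ s S c π → hasOverlined s (replicate c (S , false) ++ π) ≡ hasOverlined s π
hasOverlined-replicate s S zero    π = refl
hasOverlined-replicate s S (suc c) π = hasOverlined-replicate s S c π

countNon-replicate-same : ∀ S c π → countNon S (replicate c (S , false) ++ π) ≡ c ℕ.+ countNon S π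
countNon-replicate-same S zero    π = refl
countNon-replicate-same S (suc c) π rewrite ≡ᵇ-true (refl {x = S}) = cong suc (countNon-replicate-same S c π)

countNon-replicate-other : ∀ s S c π → S ≢ s → countNon s (replicate c (S , false) ++ π) ≡ countNon s π
countNon-replicate-other s S zero    π _   = refl
countNon-replicate-other s S (suc c) π S≢s rewrite ≡ᵇ-false S≢s = countNon-replicate-other s S c π S≢s

hasOverlined-block-same : ∀ S b c π → PartsBelow S π → hasOverlined S (block S b c ++ π) ≡ b
hasOverlined-block-same S true  c π _  rewrite ≡ᵇ-true (refl {x = S}) = refl
hasOverlined-block-same S false c π π<S =
  trans (hasOverlined-replicate S S c π) (hasOverlined-absent S π (partsBelow⇒≢ π<S))

countNon-block-same : ∀ S b c π → PartsBelow S π → countNon S (block S b c ++ π) ≡ c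
countNon-block-same S b c π π<S = begin
  countNon S (block S b c ++ π)                ≡⟨ drop-overlined b ⟩
  countNon S (replicate c (S , false) ++ π)    ≡⟨ countNon-replicate-same S c π ⟩
  c ℕ.+ countNon S π                           ≡⟨ cong (c ℕ.+_) (countNon-absent S π (partsBelow⇒≢ π<S)) ⟩
  c ℕ.+ 0                                      ≡⟨ ℕP.+-identityʳ c ⟩
  c                                            ∎
  where
  drop-overlined : ∀ b → countNon S (block S b c ++ π) ≡ countNon S (replicate c (S , false) ++ π)
  drop-overlined true  = refl
  drop-overlined false = refl

hasOverlined-block-other : ∀ s S b c π → S ≢ s → hasOverlined s (block S b c ++ π) ≡ hasOverlined s π
hasOverlined-block-other s S true  c π S≢s rewrite ≡ᵇ-false S≢s = hasOverlined-replicate s S c π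
hasOverlined-block-other s S false c π S≢s = hasOverlined-replicate s S c π

countNon-block-other : ∀ s S b c π → S ≢ s → countNon s (block S b c ++ π) ≡ countNon s π
countNon-block-other s S true  c π = countNon-replicate-other s S c π
countNon-block-other s S false c π = countNon-replicate-other s S c π

-- The block is recovered from the list through hasOverlined and countNon.
block-injective : ∀ S b c b′ c′ π π′ → PartsBelow S π → PartsBelow S π′ →
  block S b c ++ π ≡ block S b′ c′ ++ π′ → (b ≡ b′ × c ≡ c′) × π ≡ π′
block-injective S b c b′ c′ π π′ π<S π′<S eq = (b≡b′ , c≡c′) ,
  ListP.++-cancelˡ (block S b c) π π′
    (trans eq (cong₂ (λ x y → block S x y ++ π′) (sym b≡b′) (sym c≡c′)))
  where
  b≡b′ : b ≡ b′
  b≡b′ = trans (sym (hasOverlined-block-same S b c π π<S))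
               (trans (cong (hasOverlined S) eq) (hasOverlined-block-same S b′ c′ π′ π′<S))
  c≡c′ : c ≡ c′
  c≡c′ = trans (sym (countNon-block-same S b c π π<S))
               (trans (cong (countNon S) eq) (countNon-block-same S b′ c′ π′ π′<S))

∷-linked : ∀ S b π → Linked OrderedParts π → PartsBelow S π → Linked OrderedParts ((S , b) ∷ π)
∷-linked S b []             _ _         = [-]
∷-linked S b ((t , b′) ∷ π) l (t<S ∷ _) = inj₁ t<S ∷ l

∷-replicate-linked : ∀ S b c π → Linked OrderedParts π → PartsBelow S π →
  Linked OrderedParts ((S , b) ∷ replicate c (S , false) ++ π)
∷-replicate-linked S b zero    π l π<S = ∷-linked S b π l π<S
∷-replicate-linked S b (suc c) π l π<S = inj₂ (refl , refl) ∷ ∷-replicate-linked S false c π l π<S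

block-linked : ∀ S b c π → Linked OrderedParts π → PartsBelow S π → Linked OrderedParts (block S b c ++ π)
block-linked S true  c       π l π<S = ∷-replicate-linked S true c π l π<S
block-linked S false zero    π l π<S = l
block-linked S false (suc c) π l π<S = ∷-replicate-linked S false c π l π<S

block-all : ∀ (P : Part → Set) S b c → P (S , true) → P (S , false) →
  ∀ {π} → All P π → All P (block S b c ++ π)
block-all P S true  c p-overlined p-plain Pπ = p-overlined ∷ AllP.++⁺ (AllP.replicate⁺ c p-plain) Pπ
block-all P S false c p-overlined p-plain Pπ = AllP.++⁺ (AllP.replicate⁺ c p-plain) Pπ

linked-++⁻ʳ : ∀ xs {ys} → Linked OrderedParts (xs ++ ys) → Linked OrderedParts ys
linked-++⁻ʳ []       l = l
linked-++⁻ʳ (x ∷ xs) l = linked-++⁻ʳ xs (Linked.tail l)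

orderedParts⇒≥ : ∀ {x y} → OrderedParts x y → proj₁ y ≤ proj₁ x
orderedParts⇒≥ (inj₁ y<x)       = ℕP.<⇒≤ y<x
orderedParts⇒≥ (inj₂ (y≡x , _)) = ℕP.≤-reflexive y≡x

linked⇒partsAtMost : ∀ t b xs → Linked OrderedParts ((t , b) ∷ xs) → PartsAtMost t xs
linked⇒partsAtMost t b []               _       = []
linked⇒partsAtMost t b ((t′ , b′) ∷ xs) (r ∷ l) =
  t′≤t ∷ All.map (λ t″≤t′ → ℕP.≤-trans t″≤t′ t′≤t) (linked⇒partsAtMost t′ b′ xs l)
  where
  t′≤t : t′ ≤ t
  t′≤t = orderedParts⇒≥ {t , b} {t′ , b′} r

block-decomposition : ∀ S π → Linked OrderedParts π → PartsAtMost S π →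
  Σ Bool λ b → Σ ℕ λ c → Σ (List Part) λ π′ → (π ≡ block S b c ++ π′) × PartsBelow S π′
block-decomposition S []               _ _           = false , 0 , [] , refl , []
block-decomposition S ((t , b₀) ∷ xs) l (t≤S ∷ xs≤S) with ℕP.m≤n⇒m<n∨m≡n t≤S
... | inj₁ t<S = false , 0 , (t , b₀) ∷ xs , refl ,
  t<S ∷ All.map (λ t′≤t → ℕP.≤-<-trans t′≤t t<S) (linked⇒partsAtMost t b₀ xs l)
... | inj₂ refl with block-decomposition S xs (Linked.tail l) xs≤S
...   | true , c , π′ , refl , π′<S = ⊥-elim (no-second-overline (Linked.head l))
  where
  no-second-overline : ¬ OrderedParts (S , b₀) (S , true)
  no-second-overline (inj₁ S<S)     = ℕP.<-irrefl refl S<S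
  no-second-overline (inj₂ (_ , ()))
...   | false , c , π′ , refl , π′<S with b₀
...     | true  = true , c , π′ , refl , π′<S
...     | false = false , suc c , π′ , refl , π′<S

multiplicities : ℕ → ℕ → List ℕ
multiplicities s i = concatUpTo (λ c → singletonIf (s ℕ.* c ≡ᵇ i) c) i

multiplicities-length : ∀ s i → lengthℤ (multiplicities s i) ≡ invOneMinus s i
multiplicities-length s i =
  trans (concatUpTo-length _ i) (sumTo-cong i (λ c _ → singletonIf-length (s ℕ.* c ≡ᵇ i) c))

∈-multiplicities⁻ : ∀ s i {c} → c ∈ multiplicities s i → s ℕ.* c ≡ i
∈-multiplicities⁻ s i c∈ with ∈-concatUpTo⁻ _ i c∈
... | c′ , _ , c∈′ with ∈-singletonIf⁻ (s ℕ.* c′ ≡ᵇ i) c′ c∈′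
...   | eq , refl = ≡ᵇ-sound eq

∈-multiplicities⁺ : ∀ s c → 1 ≤ s → c ∈ multiplicities s (s ℕ.* c)
∈-multiplicities⁺ s@(suc s′) c _ = ∈-concatUpTo⁺ _ (s ℕ.* c) c (ℕP.m≤m+n c (s′ ℕ.* c))
  (subst (λ b → c ∈ singletonIf b c) (sym (≡ᵇ-true (refl {x = s ℕ.* c}))) (here refl))

multiplicities-unique : ∀ s i → Unique (multiplicities s i)
multiplicities-unique s i = concatUpTo-unique _ i (λ c → singletonIf-unique _ c) graded
  where
  graded : Graded (λ c → singletonIf (s ℕ.* c ≡ᵇ i) c)
  graded {c} {c′} p q = trans (sym (proj₂ (∈-singletonIf⁻ _ c p))) (proj₂ (∈-singletonIf⁻ _ c′ q))

-- The overline contributes l ∈ {0, s} to the weight of the block of size s.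
overlineChoices : ℕ → ℕ → List Bool
overlineChoices s l = singletonIf (l ≡ᵇ 0) false ++ singletonIf (l ≡ᵇ s) true

overlineChoices-length : ∀ s l → lengthℤ (overlineChoices s l) ≡ onePlus s l
overlineChoices-length s l = trans (lengthℤ-++ (singletonIf (l ≡ᵇ 0) false) _)
  (cong₂ _+_ (trans (singletonIf-length (l ≡ᵇ 0) false) (ind-≡ᵇ0 l)) (singletonIf-length (l ≡ᵇ s) true))

∈-overlineChoices⁻ : ∀ s l {b} → b ∈ overlineChoices s l → (if b then s else 0) ≡ l
∈-overlineChoices⁻ s l b∈ with ∈-++⁻ (singletonIf (l ≡ᵇ 0) false) b∈
... | inj₁ b∈₀ with ∈-singletonIf⁻ (l ≡ᵇ 0) false b∈₀
...   | eq , refl = sym (≡ᵇ-sound eq)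
∈-overlineChoices⁻ s l b∈ | inj₂ b∈ₛ with ∈-singletonIf⁻ (l ≡ᵇ s) true b∈ₛ
...   | eq , refl = sym (≡ᵇ-sound eq)

∈-overlineChoices⁺ : ∀ s b → b ∈ overlineChoices s (if b then s else 0)
∈-overlineChoices⁺ s false = here refl
∈-overlineChoices⁺ s true  = ∈-++⁺ʳ (singletonIf (s ≡ᵇ 0) false)
  (subst (λ x → true ∈ singletonIf x true) (sym (≡ᵇ-true (refl {x = s}))) (here refl))

overlineChoices-unique : ∀ s l → Unique (overlineChoices s l)
overlineChoices-unique s l =
  UniqueP.++⁺ (singletonIf-unique _ false) (singletonIf-unique _ true) disjoint
  where
  disjoint : ∀ {b} → ¬ (b ∈ singletonIf (l ≡ᵇ 0) false × b ∈ singletonIf (l ≡ᵇ s) true)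
  disjoint (p , q) with proj₂ (∈-singletonIf⁻ _ false p) | proj₂ (∈-singletonIf⁻ _ true q)
  ... | refl | ()

Blocks : Set
Blocks = ℕ → ℕ → List (Bool × ℕ)

anyBlocks : Blocks
anyBlocks s = convolveL (overlineChoices s) (multiplicities s)

anyBlocks-length : ∀ s i → lengthℤ (anyBlocks s i) ≡ (onePlus s ⊛ invOneMinus s) i
anyBlocks-length s i = trans (convolveL-length (overlineChoices s) (multiplicities s) i)
  (⊛-congUpTo {g = λ j → lengthℤ (multiplicities s j)} i
     (λ l _ → overlineChoices-length s l) (λ j _ → multiplicities-length s j))

∈-anyBlocks⁻ : ∀ s i {b c} → (b , c) ∈ anyBlocks s i → blockWeight s b c ≡ i
∈-anyBlocks⁻ s i bc∈ with ∈-convolveL⁻ (overlineChoices s) (multiplicities s) i bc∈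
... | l , l≤i , b∈ , c∈ =
  trans (cong₂ ℕ._+_ (∈-overlineChoices⁻ s l b∈) (∈-multiplicities⁻ s (i ∸ l) c∈)) (ℕP.m+[n∸m]≡n l≤i)

∈-anyBlocks⁺ : ∀ s b c → 1 ≤ s → (b , c) ∈ anyBlocks s (blockWeight s b c)
∈-anyBlocks⁺ s b c 1≤s =
  ∈-convolveL⁺ (overlineChoices s) (multiplicities s) (blockWeight s b c) l (ℕP.m≤m+n l (s ℕ.* c))
    (∈-overlineChoices⁺ s b)
    (subst (λ x → c ∈ multiplicities s x) (sym (ℕP.m+n∸m≡n l (s ℕ.* c))) (∈-multiplicities⁺ s c 1≤s))
  where
  l : ℕ
  l = if b then s else 0

anyBlocks-unique : ∀ s i → Unique (anyBlocks s i)
anyBlocks-unique s i =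
  convolveL-unique (overlineChoices s) (multiplicities s) i (overlineChoices-unique s) (multiplicities-unique s)
    (λ {l} {l′} p q → trans (sym (∈-overlineChoices⁻ s l p)) (∈-overlineChoices⁻ s l′ q))

plainBlocks : ℕ → Blocks
plainBlocks R s i = map (λ c → false , c ℕ.+ R) (shiftL (R ℕ.* s) (multiplicities s) i)

plainBlocks-length : ∀ R s i → lengthℤ (plainBlocks R s i) ≡ shift (R ℕ.* s) (invOneMinus s) i
plainBlocks-length R s i = trans (cong ℤ.+_ (ListP.length-map _ (shiftL (R ℕ.* s) (multiplicities s) i)))
  (trans (shiftL-length (R ℕ.* s) (multiplicities s) i) (shift-cong (R ℕ.* s) (multiplicities-length s) i))

∈-plainBlocks⁻ : ∀ R s i {b c} → (b , c) ∈ plainBlocks R s i →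
  (b ≡ false × R ≤ c) × blockWeight s b c ≡ i
∈-plainBlocks⁻ R s i bc∈ with ∈-map⁻ (λ c → false , c ℕ.+ R) bc∈
... | c′ , c′∈ , refl with ∈-shiftL⁻ (R ℕ.* s) (multiplicities s) i c′∈
...   | Rs≤i , c′∈′ = (refl , ℕP.m≤n+m R c′) , (begin
  s ℕ.* (c′ ℕ.+ R)             ≡⟨ ℕP.*-distribˡ-+ s c′ R ⟩
  s ℕ.* c′ ℕ.+ s ℕ.* R         ≡⟨ cong₂ ℕ._+_ (∈-multiplicities⁻ s _ c′∈′) (ℕP.*-comm s R) ⟩
  (i ∸ R ℕ.* s) ℕ.+ R ℕ.* s    ≡⟨ ℕP.m∸n+n≡m Rs≤i ⟩
  i                            ∎)

∈-plainBlocks⁺ : ∀ R s c → 1 ≤ s → R ≤ c → (false , c) ∈ plainBlocks R s (blockWeight s false c)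
∈-plainBlocks⁺ R s c 1≤s R≤c =
  subst (λ x → x ∈ plainBlocks R s (s ℕ.* c)) (cong (false ,_) (ℕP.m∸n+n≡m R≤c))
    (∈-map⁺ _ (∈-shiftL⁺ (R ℕ.* s) (multiplicities s) (s ℕ.* c) Rs≤sc
      (subst (λ x → c′ ∈ multiplicities s x) sc′≡ (∈-multiplicities⁺ s c′ 1≤s))))
  where
  c′ : ℕ
  c′ = c ∸ R
  split : s ℕ.* c ≡ s ℕ.* c′ ℕ.+ R ℕ.* s
  split = trans (cong (s ℕ.*_) (sym (ℕP.m∸n+n≡m R≤c)))
                (trans (ℕP.*-distribˡ-+ s c′ R) (cong (s ℕ.* c′ ℕ.+_) (ℕP.*-comm s R)))
  Rs≤sc : R ℕ.* s ≤ s ℕ.* c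
  Rs≤sc = subst (R ℕ.* s ≤_) (sym split) (ℕP.m≤n+m (R ℕ.* s) (s ℕ.* c′))
  sc′≡ : s ℕ.* c′ ≡ s ℕ.* c ∸ R ℕ.* s
  sc′≡ = sym (trans (cong (_∸ R ℕ.* s) split) (ℕP.m+n∸n≡m (s ℕ.* c′) (R ℕ.* s)))

plainBlocks-unique : ∀ R s i → Unique (plainBlocks R s i)
plainBlocks-unique R s i = UniqueP.map⁺ (λ eq → ℕP.+-cancelʳ-≡ R _ _ (cong proj₂ eq))
  (shiftL-unique (R ℕ.* s) (multiplicities s) i (multiplicities-unique s))

overlinedBlocks : Blocks
overlinedBlocks s i = map (true ,_) (shiftL s (multiplicities s) i)

overlinedBlocks-length : ∀ s i → lengthℤ (overlinedBlocks s i) ≡ shift s (invOneMinus s) i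
overlinedBlocks-length s i = trans (cong ℤ.+_ (ListP.length-map (true ,_) (shiftL s (multiplicities s) i)))
  (trans (shiftL-length s (multiplicities s) i) (shift-cong s (multiplicities-length s) i))

∈-overlinedBlocks⁻ : ∀ s i {b c} → (b , c) ∈ overlinedBlocks s i → b ≡ true × blockWeight s b c ≡ i
∈-overlinedBlocks⁻ s i bc∈ with ∈-map⁻ (true ,_) bc∈
... | c , c∈ , refl with ∈-shiftL⁻ s (multiplicities s) i c∈
...   | s≤i , c∈′ = refl , trans (cong (s ℕ.+_) (∈-multiplicities⁻ s _ c∈′)) (ℕP.m+[n∸m]≡n s≤i)

∈-overlinedBlocks⁺ : ∀ s c → 1 ≤ s → (true , c) ∈ overlinedBlocks s (blockWeight s true c)
∈-overlinedBlocks⁺ s c 1≤s =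
  ∈-map⁺ (true ,_) (∈-shiftL⁺ s (multiplicities s) (s ℕ.+ s ℕ.* c) (ℕP.m≤m+n s (s ℕ.* c))
  (subst (λ x → c ∈ multiplicities s x) (sym (ℕP.m+n∸m≡n s (s ℕ.* c))) (∈-multiplicities⁺ s c 1≤s)))

overlinedBlocks-unique : ∀ s i → Unique (overlinedBlocks s i)
overlinedBlocks-unique s i = UniqueP.map⁺ (cong proj₂) (shiftL-unique s (multiplicities s) i (multiplicities-unique s))

-- Enumerating overpartitions block by block

module Enumeration
  (blocks : Blocks)
  (Allowed : ℕ → Bool → ℕ → Set)
  (∈-blocks⁻ : ∀ s → 1 ≤ s → ∀ {b c i} → (b , c) ∈ blocks s i → Allowed s b c × blockWeight s b c ≡ i)
  (∈-blocks⁺ : ∀ s → 1 ≤ s → ∀ b c → Allowed s b c → (b , c) ∈ blocks s (blockWeight s b c))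
  (blocks-unique : ∀ s i → Unique (blocks s i))
  where

  prependBlock : ℕ → (Bool × ℕ) × List Part → List Part
  prependBlock S ((b , c) , π) = block S b c ++ π

  overpartitions : ℕ → ℕ → List (List Part)
  overpartitions zero    zero    = [] ∷ []
  overpartitions zero    (suc w) = []
  overpartitions (suc t) w       = map (prependBlock (suc t)) (convolveL (blocks (suc t)) (overpartitions t) w)

  Valid : ℕ → ℕ → List Part → Set
  Valid t w π = IsOverpartition π × PartsAtMost t π × weight π ≡ w ×
                (∀ s → 1 ≤ s → s ≤ t → Allowed s (hasOverlined s π) (countNon s π))

  overpartitions-length : ∀ t w → lengthℤ (overpartitions t w) ≡ prodDown (λ s i → lengthℤ (blocks s i)) t w
  overpartitions-length zero    zero    = refl
  overpartitions-length zero    (suc w) = refl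
  overpartitions-length (suc t) w       = begin
    lengthℤ (map (prependBlock (suc t)) (convolveL (blocks (suc t)) (overpartitions t) w))
      ≡⟨ cong ℤ.+_ (ListP.length-map (prependBlock (suc t)) (convolveL (blocks (suc t)) (overpartitions t) w)) ⟩
    lengthℤ (convolveL (blocks (suc t)) (overpartitions t) w)
      ≡⟨ convolveL-length (blocks (suc t)) (overpartitions t) w ⟩
    ((λ i → lengthℤ (blocks (suc t) i)) ⊛ (λ j → lengthℤ (overpartitions t j))) w
      ≡⟨ ⊛-congUpTo {λ i → lengthℤ (blocks (suc t) i)} w (λ _ _ → refl)
                    (λ j _ → overpartitions-length t j) ⟩
    prodDown (λ s i → lengthℤ (blocks s i)) (suc t) w ∎

  ∈-overpartitions⁻ : ∀ t w π → π ∈ overpartitions t w → Valid t w π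
  ∈-overpartitions⁻ zero zero .[] (here refl) =
    ([] , []) , [] , refl , (λ s 1≤s s≤0 → ⊥-elim (ℕP.<⇒≱ 1≤s s≤0))
  ∈-overpartitions⁻ (suc t) w π π∈ with ∈-map⁻ (prependBlock (suc t)) π∈
  ... | ((b , c) , π′) , bcπ′∈ , refl with ∈-convolveL⁻ (blocks (suc t)) (overpartitions t) w bcπ′∈
  ... | i , i≤w , bc∈ , π′∈ with ∈-overpartitions⁻ t (w ∸ i) π′ π′∈ | ∈-blocks⁻ (suc t) (s≤s z≤n) bc∈
  ... | (positive , linked) , π′≤t , weight≡ , allowed | allowedS , weightS≡i =
    (block-all _ S b c (s≤s z≤n) (s≤s z≤n) positive , block-linked S b c π′ linked π′<S) ,
    block-all _ S b c ℕP.≤-refl ℕP.≤-refl (All.map ℕP.m≤n⇒m≤1+n π′≤t) ,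
    trans (weight-block S b c π′) (trans (cong₂ ℕ._+_ weightS≡i weight≡) (ℕP.m+[n∸m]≡n i≤w)) ,
    allowed′
    where
    S : ℕ
    S = suc t
    π′<S : PartsBelow S π′
    π′<S = All.map s≤s π′≤t
    allowed′ : ∀ s → 1 ≤ s → s ≤ S →
      Allowed s (hasOverlined s (block S b c ++ π′)) (countNon s (block S b c ++ π′))
    allowed′ s 1≤s s≤S with ℕP.m≤n⇒m<n∨m≡n s≤S
    ... | inj₂ refl = subst₂ (Allowed s) (sym (hasOverlined-block-same S b c π′ π′<S))
                                         (sym (countNon-block-same S b c π′ π′<S)) allowedS
    ... | inj₁ (s≤s s≤t) = subst₂ (Allowed s) (sym (hasOverlined-block-other s S b c π′ S≢s))
                                              (sym (countNon-block-other s S b c π′ S≢s)) (allowed s 1≤s s≤t)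
      where
      S≢s : S ≢ s
      S≢s = λ eq → ℕP.<⇒≢ (s≤s s≤t) (sym eq)

  ∈-overpartitions⁺ : ∀ t w π → Valid t w π → π ∈ overpartitions t w
  ∈-overpartitions⁺ zero w []               (_ , _ , refl , _) = here refl
  ∈-overpartitions⁺ zero w ((t′ , _) ∷ _) ((1≤t′ ∷ _ , _) , t′≤0 ∷ _ , _) = ⊥-elim (ℕP.<⇒≱ 1≤t′ t′≤0)
  ∈-overpartitions⁺ (suc t) w π ((positive , linked) , π≤S , weight≡ , allowed)
    with block-decomposition (suc t) π linked π≤S
  ... | b , c , π′ , refl , π′<S =
    ∈-map⁺ (prependBlock S) (∈-convolveL⁺ (blocks S) (overpartitions t) w i i≤w bc∈ π′∈)
    where
    S : ℕ
    S = suc t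
    i : ℕ
    i = blockWeight S b c
    weight-split : i ℕ.+ weight π′ ≡ w
    weight-split = trans (sym (weight-block S b c π′)) weight≡
    i≤w : i ≤ w
    i≤w = subst (i ≤_) weight-split (ℕP.m≤m+n i (weight π′))
    bc∈ : (b , c) ∈ blocks S i
    bc∈ = ∈-blocks⁺ S (s≤s z≤n) b c (subst₂ (Allowed S) (hasOverlined-block-same S b c π′ π′<S)
            (countNon-block-same S b c π′ π′<S) (allowed S (s≤s z≤n) ℕP.≤-refl))
    allowed′ : ∀ s → 1 ≤ s → s ≤ t → Allowed s (hasOverlined s π′) (countNon s π′)
    allowed′ s 1≤s s≤t = subst₂ (Allowed s) (hasOverlined-block-other s S b c π′ S≢s)
      (countNon-block-other s S b c π′ S≢s) (allowed s 1≤s (ℕP.m≤n⇒m≤1+n s≤t))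
      where
      S≢s : S ≢ s
      S≢s = λ eq → ℕP.<⇒≢ (s≤s s≤t) (sym eq)
    π′∈ : π′ ∈ overpartitions t (w ∸ i)
    π′∈ = ∈-overpartitions⁺ t (w ∸ i) π′
      ( (AllP.++⁻ʳ (block S b c) positive , linked-++⁻ʳ (block S b c) linked)
      , All.map (λ { (s≤s s≤t) → s≤t }) π′<S
      , sym (trans (cong (_∸ i) (sym weight-split)) (ℕP.m+n∸m≡n i (weight π′)))
      , allowed′)

  overpartitions-unique : ∀ t w → Unique (overpartitions t w)
  overpartitions-unique zero    zero    = [] ∷ []
  overpartitions-unique zero    (suc w) = []
  overpartitions-unique (suc t) w       = map⁺-injectiveOn (prependBlock S)
    (convolveL-unique (blocks S) (overpartitions t) w (blocks-unique S) (overpartitions-unique t) graded)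
    injective
    where
    S : ℕ
    S = suc t
    graded : Graded (blocks S)
    graded p q = trans (sym (proj₂ (∈-blocks⁻ S (s≤s z≤n) p))) (proj₂ (∈-blocks⁻ S (s≤s z≤n) q))
    below : ∀ {i π} → π ∈ overpartitions t (w ∸ i) → PartsBelow S π
    below {i} {π} π∈ = All.map s≤s (proj₁ (proj₂ (∈-overpartitions⁻ t (w ∸ i) π π∈)))
    injective : ∀ {x y} → x ∈ convolveL (blocks S) (overpartitions t) w →
      y ∈ convolveL (blocks S) (overpartitions t) w → prependBlock S x ≡ prependBlock S y → x ≡ y
    injective {(b , c) , π} {(b′ , c′) , π′} p q eq
      with ∈-convolveL⁻ (blocks S) (overpartitions t) w p | ∈-convolveL⁻ (blocks S) (overpartitions t) w q
    ... | i , _ , _ , π∈ | i′ , _ , _ , π′∈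
      with block-injective S b c b′ c′ π π′ (below {i} π∈) (below {i′} π′∈) eq
    ...   | (refl , refl) , refl = refl

module _ (P : ℕ → Set) (P? : ∀ j → Dec (P j)) where

  first-below : ∀ n → (∃ λ k → k < n × P k × (∀ j → j < k → ¬ P j)) ⊎ (∀ j → j < n → ¬ P j)
  first-below zero = inj₂ (λ j ())
  first-below (suc n) with first-below n
  ... | inj₁ (k , k<n , Pk , minimal) = inj₁ (k , ℕP.m≤n⇒m≤1+n k<n , Pk , minimal)
  ... | inj₂ none with P? n
  ...   | yes Pn = inj₁ (n , ℕP.≤-refl , Pn , none)
  ...   | no ¬Pn = inj₂ none-below-suc
    where
    none-below-suc : ∀ j → j < suc n → ¬ P j
    none-below-suc j (s≤s j≤n) with ℕP.m≤n⇒m<n∨m≡n j≤n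
    ... | inj₁ j<n  = none j j<n
    ... | inj₂ refl = ¬Pn

  least : ∀ J → P J → ∃ λ k → k ≤ J × P k × (∀ j → j < k → ¬ P j)
  least J PJ with first-below (suc J)
  ... | inj₁ (k , s≤s k≤J , Pk , minimal) = k , k≤J , Pk , minimal
  ... | inj₂ none = ⊥-elim (none J ℕP.≤-refl PJ)

module Progression (A a : ℕ) (1≤a : 1 ≤ a) (a≤A : a ≤ A) where

  1≤A : 1 ≤ A
  1≤A = ℕP.≤-trans 1≤a a≤A

  m : ℕ → ℕ
  m j = a ℕ.+ j ℕ.* A

  1≤m : ∀ j → 1 ≤ m j
  1≤m j = ℕP.≤-trans 1≤a (ℕP.m≤m+n a (j ℕ.* A))

  m-mono-< : ∀ {j k} → j < k → m j < m k
  m-mono-< j<k = ℕP.+-monoʳ-< a (ℕP.*-monoˡ-< A {{ℕ.>-nonZero 1≤A}} j<k)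

  m-mono-≤ : ∀ {j k} → j ≤ k → m j ≤ m k
  m-mono-≤ j≤k = ℕP.+-monoʳ-≤ a (ℕP.*-monoˡ-≤ A j≤k)

  m-injective : ∀ {j k} → m j ≡ m k → j ≡ k
  m-injective {j} {k} eq with ℕP.<-cmp j k
  ... | tri< j<k _ _ = ⊥-elim (ℕP.<⇒≢ (m-mono-< j<k) eq)
  ... | tri≈ _ j≡k _ = j≡k
  ... | tri> _ _ k<j = ⊥-elim (ℕP.<⇒≢ (m-mono-< k<j) (sym eq))

  <m : ∀ k → k < m k
  <m k = ℕP.≤-trans (s≤s (subst (_≤ k ℕ.* A) (ℕP.*-identityʳ k) (ℕP.*-monoʳ-≤ k 1≤A)))
                    (ℕP.+-monoˡ-≤ (k ℕ.* A) 1≤a)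

  ∣+t-+a∣≡∣t⊖a∣ : ∀ t → ℤ.∣ ℤ.+ t ℤ.- ℤ.+ a ∣ ≡ ℤ.∣ t ℤ.⊖ a ∣
  ∣+t-+a∣≡∣t⊖a∣ t = cong ℤ.∣_∣ (ℤP.m-n≡m⊖n t a)

  congr-m : ∀ j → Congr A (m j) a
  congr-m j = divides j (begin
    ℤ.∣ ℤ.+ m j ℤ.- ℤ.+ a ∣   ≡⟨ ∣+t-+a∣≡∣t⊖a∣ (m j) ⟩
    ℤ.∣ m j ℤ.⊖ a ∣          ≡⟨ cong ℤ.∣_∣ (ℤP.⊖-≥ (ℕP.m≤m+n a (j ℕ.* A))) ⟩
    m j ∸ a                 ≡⟨ ℕP.m+n∸m≡n a (j ℕ.* A) ⟩
    j ℕ.* A                 ∎)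

  -- A positive t ≡ a (mod A) cannot lie below a, since 0 < a − t < A when t < a.
  congr⇒m : ∀ t → 1 ≤ t → Congr A t a → ∃ λ j → t ≡ m j
  congr⇒m t 1≤t (divides q eq) with a ℕ.≤? t
  ... | yes a≤t = q , sym (trans (cong (a ℕ.+_) (sym t∸a≡qA)) (ℕP.m+[n∸m]≡n a≤t))
    where
    t∸a≡qA : t ∸ a ≡ q ℕ.* A
    t∸a≡qA = trans (sym (trans (∣+t-+a∣≡∣t⊖a∣ t) (cong ℤ.∣_∣ (ℤP.⊖-≥ a≤t)))) eq
  ... | no a≰t = ⊥-elim (impossible q a∸t≡qA)
    where
    t<a : t < a
    t<a = ℕP.≰⇒> a≰t
    a∸t≡qA : a ∸ t ≡ q ℕ.* A
    a∸t≡qA = trans (sym (trans (∣+t-+a∣≡∣t⊖a∣ t)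
               (trans (cong ℤ.∣_∣ (ℤP.⊖-< t<a)) (ℤP.∣-i∣≡∣i∣ (ℤ.+ (a ∸ t)))))) eq
    a∸t<A : a ∸ t < A
    a∸t<A = ℕP.<-≤-trans (ℕP.∸-monoʳ-< {a} {t} {0} 1≤t (ℕP.<⇒≤ t<a)) a≤A
    impossible : ∀ q → a ∸ t ≢ q ℕ.* A
    impossible zero    e = ℕP.<⇒≢ (ℕP.m<n⇒0<n∸m t<a) (sym e)
    impossible (suc q) e = ℕP.<⇒≱ a∸t<A (subst (A ≤_) (sym e) (ℕP.m≤m+n A (q ℕ.* A)))

  isEarlier : ℕ → ℕ → Bool
  isEarlier zero    s = false
  isEarlier (suc k) s = isEarlier k s ∨ (s ≡ᵇ m k)

  isEarlier-sound : ∀ k s → isEarlier k s ≡ true → ∃ λ j → j < k × s ≡ m j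
  isEarlier-sound (suc k) s _ with isEarlier k s in earlier | s ≡ᵇ m k in s≡mk
  ... | true | _ with isEarlier-sound k s earlier
  ...   | j , j<k , s≡mj = j , ℕP.m≤n⇒m≤1+n j<k , s≡mj
  isEarlier-sound (suc k) s _ | false | true = k , ℕP.≤-refl , ≡ᵇ-sound s≡mk

  isEarlier-complete : ∀ k j → j < k → isEarlier k (m j) ≡ true
  isEarlier-complete (suc k) j j<1+k with ℕP.m≤n⇒m<n∨m≡n j<1+k
  ... | inj₁ (s≤s j<k) rewrite isEarlier-complete k j j<k = refl
  ... | inj₂ refl rewrite ≡ᵇ-true (refl {x = m j}) = BoolP.∨-zeroʳ (isEarlier j (m j))

  pivot-not-earlier : ∀ k s → (s ≡ᵇ m k) ≡ true → isEarlier k s ≢ true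
  pivot-not-earlier k s s≡mk earlier with isEarlier-sound k s earlier
  ... | j , j<k , s≡mj = ℕP.<⇒≢ j<k (m-injective (trans (sym s≡mj) (≡ᵇ-sound s≡mk)))

-- Counting overpartitions by their pivot

module Counting (A a r : ℕ) (1≤a : 1 ≤ a) (a≤A : a ≤ A) where

  open Progression A a 1≤a a≤A public

  R : ℕ
  R = r ∸ 1

  -- The three kinds of sizes: the pivot m k (first argument), an earlier m j (second), or any other size.
  blocksFor : Bool → Bool → Blocks
  blocksFor true  _     = overlinedBlocks
  blocksFor false true  = plainBlocks R
  blocksFor false false = anyBlocks

  AllowedFor : Bool → Bool → Bool → ℕ → Set
  AllowedFor true  _     b c = b ≡ true
  AllowedFor false true  b c = b ≡ false × R ≤ c
  AllowedFor false false b c = ⊤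

  factorFor : Bool → Bool → ℕ → Series
  factorFor true  _     s = shift s (invOneMinus s)
  factorFor false true  s = shift (R ℕ.* s) (invOneMinus s)
  factorFor false false s = onePlus s ⊛ invOneMinus s

  ∈-blocksFor⁻ : ∀ x y s → 1 ≤ s → ∀ {b c i} → (b , c) ∈ blocksFor x y s i →
    AllowedFor x y b c × blockWeight s b c ≡ i
  ∈-blocksFor⁻ true  y     s _ bc∈ = ∈-overlinedBlocks⁻ s _ bc∈
  ∈-blocksFor⁻ false true  s _ bc∈ = ∈-plainBlocks⁻ R s _ bc∈
  ∈-blocksFor⁻ false false s _ bc∈ = tt , ∈-anyBlocks⁻ s _ bc∈

  ∈-blocksFor⁺ : ∀ x y s → 1 ≤ s → ∀ b c → AllowedFor x y b c →
    (b , c) ∈ blocksFor x y s (blockWeight s b c)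
  ∈-blocksFor⁺ true  y     s 1≤s .true  c refl         = ∈-overlinedBlocks⁺ s c 1≤s
  ∈-blocksFor⁺ false true  s 1≤s .false c (refl , R≤c) = ∈-plainBlocks⁺ R s c 1≤s R≤c
  ∈-blocksFor⁺ false false s 1≤s b      c tt           = ∈-anyBlocks⁺ s b c 1≤s

  blocksFor-unique : ∀ x y s i → Unique (blocksFor x y s i)
  blocksFor-unique true  y     = overlinedBlocks-unique
  blocksFor-unique false true  = plainBlocks-unique R
  blocksFor-unique false false = anyBlocks-unique

  blocksFor-length : ∀ x y s i → lengthℤ (blocksFor x y s i) ≡ factorFor x y s i
  blocksFor-length true  y     = overlinedBlocks-length
  blocksFor-length false true  = plainBlocks-length R
  blocksFor-length false false = anyBlocks-length

  blocksAt : ℕ → Blocks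
  blocksAt k s = blocksFor (s ≡ᵇ m k) (isEarlier k s) s

  AllowedAt : ℕ → ℕ → Bool → ℕ → Set
  AllowedAt k s = AllowedFor (s ≡ᵇ m k) (isEarlier k s)

  factorAt : ℕ → ℕ → Series
  factorAt k s = factorFor (s ≡ᵇ m k) (isEarlier k s) s

  freeFactor : ℕ → Series
  freeFactor s = onePlus s ⊛ invOneMinus s

  freeFactor⊛invOnePlus : ∀ s → 1 ≤ s → freeFactor s ⊛ invOnePlus s ≈ invOneMinus s
  freeFactor⊛invOnePlus s 1≤s n = begin
    ((onePlus s ⊛ invOneMinus s) ⊛ invOnePlus s) n
      ≡⟨ ⊛-cong {g = invOnePlus s} (⊛-comm (onePlus s) (invOneMinus s)) ≈-refl n ⟩
    ((invOneMinus s ⊛ onePlus s) ⊛ invOnePlus s) n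
      ≡⟨ ⊛-assoc (invOneMinus s) (onePlus s) (invOnePlus s) n ⟩
    (invOneMinus s ⊛ (onePlus s ⊛ invOnePlus s)) n
      ≡⟨ ⊛-cong {invOneMinus s} ≈-refl (onePlus⊛invOnePlus s 1≤s) n ⟩
    (invOneMinus s ⊛ one) n
      ≡⟨ ⊛-identityʳ (invOneMinus s) n ⟩
    invOneMinus s n ∎

  invOnePlusIfEarlier : ℕ → ℕ → Series
  invOnePlusIfEarlier k s = if isEarlier k s then invOnePlus s else one

  invOnePlusIfPivot : ℕ → ℕ → Series
  invOnePlusIfPivot k s = if s ≡ᵇ m k then invOnePlus (m k) else one

  earlierShift : ℕ → ℕ → ℕ
  earlierShift k s = if isEarlier k s then R ℕ.* s else 0

  pivotShift : ℕ → ℕ → ℕ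
  pivotShift k s = if s ≡ᵇ m k then m k else 0

  shiftAt : ℕ → ℕ → ℕ
  shiftAt k s = earlierShift k s ℕ.+ pivotShift k s

  -- q^{Rs}/(1 − q^s) and q^s/(1 − q^s) are (1 + q^s)/(1 − q^s) · q^{Rs}/(1 + q^s) and · q^s/(1 + q^s).
  factorAt≈ : ∀ k s → 1 ≤ s → factorAt k s ≈ shift (shiftAt k s) (freeFactor s ⊛ invOnePlusIfEarlier (suc k) s)
  factorAt≈ k s 1≤s with s ≡ᵇ m k in s≡mk | isEarlier k s in earlier
  ... | true  | true  = ⊥-elim (pivot-not-earlier k s s≡mk earlier)
  ... | true  | false = ≈-trans {j = shift (m k) (invOneMinus s)}
                          (λ n → cong (λ x → shift x (invOneMinus s) n) (≡ᵇ-sound {s} {m k} s≡mk))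
                          (shift-cong (m k) (≈-sym (freeFactor⊛invOnePlus s 1≤s)))
  ... | false | true  = λ n → trans (cong (λ x → shift x (invOneMinus s) n) (sym (ℕP.+-identityʳ (R ℕ.* s))))
                          (shift-cong (R ℕ.* s ℕ.+ 0) (≈-sym (freeFactor⊛invOnePlus s 1≤s)) n)
  ... | false | false = ≈-sym (⊛-identityʳ (freeFactor s))

  invOnePlusIfEarlier-suc : ∀ k s → invOnePlusIfEarlier (suc k) s ≈ invOnePlusIfEarlier k s ⊛ invOnePlusIfPivot k s
  invOnePlusIfEarlier-suc k s with isEarlier k s in earlier | s ≡ᵇ m k in s≡mk
  ... | true  | true  = ⊥-elim (pivot-not-earlier k s s≡mk earlier)
  ... | true  | false = ≈-sym (⊛-identityʳ (invOnePlus s))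
  ... | false | true  = ≈-trans {j = invOnePlus (m k)}
                          (λ n → cong (λ x → invOnePlus x n) (≡ᵇ-sound {s} {m k} s≡mk))
                          (≈-sym (⊛-identityˡ (invOnePlus (m k))))
  ... | false | false = ≈-sym (⊛-identityˡ one)

  prodDown-invOnePlusIfEarlier : ∀ k T → (∀ j → j < k → m j ≤ T) →
    prodDown (invOnePlusIfEarlier k) T ≈ prodRange (λ j → invOnePlus (m j)) 0 k
  prodDown-invOnePlusIfEarlier zero    T _     = prodDown-one T
  prodDown-invOnePlusIfEarlier (suc k) T m<T n = begin
    prodDown (invOnePlusIfEarlier (suc k)) T n
      ≡⟨ prodDown-cong T (λ s _ _ → invOnePlusIfEarlier-suc k s) n ⟩
    prodDown (λ s → invOnePlusIfEarlier k s ⊛ invOnePlusIfPivot k s) T n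
      ≡⟨ prodDown-⊛ (invOnePlusIfEarlier k) (invOnePlusIfPivot k) T n ⟩
    (prodDown (invOnePlusIfEarlier k) T ⊛ prodDown (invOnePlusIfPivot k) T) n
      ≡⟨ ⊛-cong (prodDown-invOnePlusIfEarlier k T (λ j j<k → m<T j (ℕP.m≤n⇒m≤1+n j<k)))
                (prodDown-point (invOnePlus (m k)) (m k) T (1≤m k) (m<T k ℕP.≤-refl)) n ⟩
    (prodRange (λ j → invOnePlus (m j)) 0 k ⊛ invOnePlus (m k)) n
      ≡⟨ prodRange-snoc (λ j → invOnePlus (m j)) 0 k n ⟨
    prodRange (λ j → invOnePlus (m j)) 0 (suc k) n ∎

  earlierShift-suc : ∀ k s → earlierShift (suc k) s ≡ earlierShift k s ℕ.+ (if s ≡ᵇ m k then R ℕ.* m k else 0)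
  earlierShift-suc k s with isEarlier k s in earlier | s ≡ᵇ m k in s≡mk
  ... | true  | true  = ⊥-elim (pivot-not-earlier k s s≡mk earlier)
  ... | true  | false = sym (ℕP.+-identityʳ _)
  ... | false | true  = cong (R ℕ.*_) (≡ᵇ-sound {s} {m k} s≡mk)
  ... | false | false = refl

  sumDown-earlierShift : ∀ k T → (∀ j → j < k → m j ≤ T) →
    sumDown (earlierShift k) T ≡ R ℕ.* (A ℕ.* (k C 2) ℕ.+ k ℕ.* a)
  sumDown-earlierShift zero    T _ =
    trans (sumDown-zero T) (sym (trans (cong (λ x → R ℕ.* (x ℕ.+ 0)) (ℕP.*-zeroʳ A)) (ℕP.*-zeroʳ R)))
  sumDown-earlierShift (suc k) T m<T = begin
    sumDown (earlierShift (suc k)) T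
      ≡⟨ sumDown-cong T (λ s _ _ → earlierShift-suc k s) ⟩
    sumDown (λ s → earlierShift k s ℕ.+ (if s ≡ᵇ m k then R ℕ.* m k else 0)) T
      ≡⟨ sumDown-+ (earlierShift k) _ T ⟩
    sumDown (earlierShift k) T ℕ.+ sumDown (λ s → if s ≡ᵇ m k then R ℕ.* m k else 0) T
      ≡⟨ cong₂ ℕ._+_ (sumDown-earlierShift k T (λ j j<k → m<T j (ℕP.m≤n⇒m≤1+n j<k)))
                     (sumDown-point (R ℕ.* m k) (m k) T (1≤m k) (m<T k ℕP.≤-refl)) ⟩
    R ℕ.* (A ℕ.* (k C 2) ℕ.+ k ℕ.* a) ℕ.+ R ℕ.* m k
      ≡⟨ collect R A a k (k C 2) ⟩
    R ℕ.* (A ℕ.* (k ℕ.+ k C 2) ℕ.+ suc k ℕ.* a)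
      ≡⟨ cong (λ x → R ℕ.* (A ℕ.* x ℕ.+ suc k ℕ.* a)) (sym (pascal k)) ⟩
    R ℕ.* (A ℕ.* (suc k C 2) ℕ.+ suc k ℕ.* a) ∎
    where
    collect : ∀ R A a k X → R ℕ.* (A ℕ.* X ℕ.+ k ℕ.* a) ℕ.+ R ℕ.* (a ℕ.+ k ℕ.* A) ≡
                            R ℕ.* (A ℕ.* (k ℕ.+ X) ℕ.+ suc k ℕ.* a)
    collect = solve-∀
    pascal : ∀ k → suc k C 2 ≡ k ℕ.+ k C 2
    pascal k = trans (sym (nCk+nC[k+1]≡[n+1]C[k+1] k 1)) (cong (ℕ._+ k C 2) (nC1≡n k))

  exponent-split : ∀ k → R ℕ.* (A ℕ.* (k C 2) ℕ.+ k ℕ.* a) ℕ.+ m k ≡ exponent r A a k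
  exponent-split k = rearrange (R ℕ.* (A ℕ.* (k C 2) ℕ.+ k ℕ.* a)) a k A
    where
    rearrange : ∀ X a k A → X ℕ.+ (a ℕ.+ k ℕ.* A) ≡ X ℕ.+ k ℕ.* A ℕ.+ a
    rearrange = solve-∀

  m≤exponent : ∀ k → m k ≤ exponent r A a k
  m≤exponent k = subst (m k ≤_) (exponent-split k) (ℕP.m≤n+m (m k) (R ℕ.* (A ℕ.* (k C 2) ℕ.+ k ℕ.* a)))

  sumDown-shiftAt : ∀ k T → m k ≤ T → sumDown (shiftAt k) T ≡ exponent r A a k
  sumDown-shiftAt k T mk≤T = begin
    sumDown (shiftAt k) T
      ≡⟨ sumDown-+ (earlierShift k) (pivotShift k) T ⟩
    sumDown (earlierShift k) T ℕ.+ sumDown (pivotShift k) T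
      ≡⟨ cong₂ ℕ._+_ (sumDown-earlierShift k T (λ j j<k → ℕP.≤-trans (m-mono-≤ (ℕP.<⇒≤ j<k)) mk≤T))
                     (sumDown-point (m k) (m k) T (1≤m k) mk≤T) ⟩
    R ℕ.* (A ℕ.* (k C 2) ℕ.+ k ℕ.* a) ℕ.+ m k
      ≡⟨ exponent-split k ⟩
    exponent r A a k ∎

  prodDown-factorAt : ∀ k T → m k ≤ T →
    prodDown (factorAt k) T ≈ shift (exponent r A a k) ((prodDown onePlus T ⊛ prodDown invOneMinus T) ⊛ invPoch A a k)
  prodDown-factorAt k T mk≤T n = begin
    prodDown (factorAt k) T n
      ≡⟨ prodDown-cong T (λ s 1≤s _ → factorAt≈ k s 1≤s) n ⟩
    prodDown (λ s → shift (shiftAt k s) (freeFactor s ⊛ invOnePlusIfEarlier (suc k) s)) T n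
      ≡⟨ prodDown-shift (shiftAt k) (λ s → freeFactor s ⊛ invOnePlusIfEarlier (suc k) s) T n ⟩
    shift (sumDown (shiftAt k) T) (prodDown (λ s → freeFactor s ⊛ invOnePlusIfEarlier (suc k) s) T) n
      ≡⟨ cong (λ e → shift e (prodDown (λ s → freeFactor s ⊛ invOnePlusIfEarlier (suc k) s) T) n)
              (sumDown-shiftAt k T mk≤T) ⟩
    shift (exponent r A a k) (prodDown (λ s → freeFactor s ⊛ invOnePlusIfEarlier (suc k) s) T) n
      ≡⟨ shift-cong (exponent r A a k) (≈-trans (prodDown-⊛ freeFactor (invOnePlusIfEarlier (suc k)) T)
           (⊛-cong (prodDown-⊛ onePlus invOneMinus T) (prodDown-invOnePlusIfEarlier (suc k) T m<T))) n ⟩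
    shift (exponent r A a k) ((prodDown onePlus T ⊛ prodDown invOneMinus T) ⊛ invPoch A a k) n ∎
    where
    m<T : ∀ j → j < suc k → m j ≤ T
    m<T j (s≤s j≤k) = ℕP.≤-trans (m-mono-≤ j≤k) mk≤T

  PivotAt : ℕ → List Part → Set
  PivotAt k π = hasOverlined (m k) π ≡ true ×
                (∀ j → j < k → hasOverlined (m j) π ≡ false × R ≤ countNon (m j) π)

  pivotAt-unique : ∀ {k k′ π} → PivotAt k π → PivotAt k′ π → k ≡ k′
  pivotAt-unique {k} {k′} (pivot , earlier) (pivot′ , earlier′) with ℕP.<-cmp k k′
  ... | tri< k<k′ _ _ = ⊥-elim (BoolP.not-¬ pivot (proj₁ (earlier′ k k<k′)))
  ... | tri≈ _ k≡k′ _ = k≡k′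
  ... | tri> _ _ k′<k = ⊥-elim (BoolP.not-¬ pivot′ (proj₁ (earlier k′ k′<k)))

  AllowedUpTo : ℕ → ℕ → List Part → Set
  AllowedUpTo k T π = ∀ s → 1 ≤ s → s ≤ T → AllowedAt k s (hasOverlined s π) (countNon s π)

  allowedUpTo⇒pivotAt : ∀ k T π → m k ≤ T → AllowedUpTo k T π → PivotAt k π
  allowedUpTo⇒pivotAt k T π mk≤T allowed =
    pivot-allowed (≡ᵇ-true (refl {x = m k})) (allowed (m k) (1≤m k) mk≤T) ,
    λ j j<k → earlier-allowed (≡ᵇ-false (ℕP.<⇒≢ (m-mono-< j<k))) (isEarlier-complete k j j<k)
                (allowed (m j) (1≤m j) (ℕP.≤-trans (ℕP.<⇒≤ (m-mono-< j<k)) mk≤T))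
    where
    pivot-allowed : ∀ {x y b c} → x ≡ true → AllowedFor x y b c → b ≡ true
    pivot-allowed refl b≡true = b≡true
    earlier-allowed : ∀ {x y b c} → x ≡ false → y ≡ true → AllowedFor x y b c → b ≡ false × R ≤ c
    earlier-allowed refl refl allowed = allowed

  pivotAt⇒allowedUpTo : ∀ k T π → PivotAt k π → AllowedUpTo k T π
  pivotAt⇒allowedUpTo k T π (pivot , earlier) s _ _ with s ≡ᵇ m k in s≡mk | isEarlier k s in s-earlier
  ... | true  | _    = subst (λ x → hasOverlined x π ≡ true) (sym (≡ᵇ-sound {s} {m k} s≡mk)) pivot
  ... | false | true with isEarlier-sound k s s-earlier
  ...   | j , j<k , refl = earlier j j<k
  pivotAt⇒allowedUpTo k T π _ s _ _ | false | false = tt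

  FreeAt : List Part → ℕ → Set
  FreeAt π j = hasOverlined (m j) π ≡ false × countNon (m j) π < R

  freeAt? : ∀ π j → Dec (FreeAt π j)
  freeAt? π j with hasOverlined (m j) π BoolP.≟ false | suc (countNon (m j) π) ℕ.≤? R
  ... | yes p | yes q = yes (p , q)
  ... | no ¬p | _     = no (¬p ∘ proj₁)
  ... | _     | no ¬q = no (¬q ∘ proj₂)

  freeAt⇔free : ∀ π j → FreeAt π j ⇔ Free r π (m j)
  freeAt⇔free π j = mk⇔
    (λ (not-overlined , few) →
      (λ overlined → BoolP.not-¬ (hasOverlined-∈⁺ (m j) π overlined) not-overlined) , few)
    (λ (not-overlined , few) → BoolP.¬-not (not-overlined ∘ hasOverlined-∈⁻ (m j) π) , few)

  -- The least overlined m k is the pivot: an earlier m j with fewer than R copies would be a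
  -- smaller available value than mes~, yet mes~ exceeds an overlined part, hence exceeds m k.
  counted⇒pivotAt : ∀ π → IsOverpartition π → Counted r A a π → ∃ λ k → PivotAt k π
  counted⇒pivotAt π (positive , _) (t , t∈ , congr-t , mes , (_ , _ , _ , mes-least) , t<mes)
    with congr⇒m t (All.lookup positive t∈) congr-t
  ... | j₁ , refl with least (λ j → hasOverlined (m j) π ≡ true) (λ j → hasOverlined (m j) π BoolP.≟ true) j₁
                             (hasOverlined-∈⁺ (m j₁) π t∈)
  ... | k , k≤j₁ , pivot , below-not-overlined = k , pivot , earlier
    where
    earlier : ∀ j → j < k → hasOverlined (m j) π ≡ false × R ≤ countNon (m j) π
    earlier j j<k = not-overlined , many
      where
      not-overlined : hasOverlined (m j) π ≡ false
      not-overlined = BoolP.¬-not (below-not-overlined j j<k)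
      many : R ≤ countNon (m j) π
      many with R ℕ.≤? countNon (m j) π
      ... | yes R≤ = R≤
      ... | no  R≰ = ⊥-elim (ℕP.<⇒≱ mj<mes (mes-least (m j) (1≤m j) (congr-m j)
                       (Equivalence.to (freeAt⇔free π j) (not-overlined , ℕP.≰⇒> R≰))))
        where
        mj<mes : m j < mes
        mj<mes = ℕP.<-trans (ℕP.<-≤-trans (m-mono-< j<k) (m-mono-≤ k≤j₁)) t<mes

  -- mes~ is m j₀ for the least available j₀; parts larger than the weight are absent, so j₀ exists.
  pivotAt⇒counted : 2 ≤ r → ∀ π k → PivotAt k π → Counted r A a π
  pivotAt⇒counted 2≤r π k (pivot , earlier) with least (FreeAt π) (freeAt? π) (weight π) free-beyond-weight
    where
    absent : All (λ p → proj₁ p ≢ m (weight π)) π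
    absent = All.map (λ p≤w p≡m → ℕP.<⇒≱ (<m (weight π)) (subst (_≤ weight π) p≡m p≤w))
                     (partsAtMost-weight π)
    free-beyond-weight : FreeAt π (weight π)
    free-beyond-weight = hasOverlined-absent (m (weight π)) π absent ,
      subst (_< R) (sym (countNon-absent (m (weight π)) π absent)) (ℕP.∸-monoˡ-≤ 1 2≤r)
  ... | j₀ , _ , free-j₀ , below-not-free =
    m k , hasOverlined-∈⁻ (m k) π pivot , congr-m k , m j₀ ,
    (1≤m j₀ , congr-m j₀ , Equivalence.to (freeAt⇔free π j₀) free-j₀ , mj₀-least) , m-mono-< k<j₀
    where
    mj₀-least : ∀ m′ → 1 ≤ m′ → Congr A m′ a → Free r π m′ → m j₀ ≤ m′
    mj₀-least m′ 1≤m′ congr free with congr⇒m m′ 1≤m′ congr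
    ... | j′ , refl with ℕP.<-cmp j′ j₀
    ...   | tri< j′<j₀ _ _ = ⊥-elim (below-not-free j′ j′<j₀ (Equivalence.from (freeAt⇔free π j′) free))
    ...   | tri≈ _ j′≡j₀ _ = ℕP.≤-reflexive (cong m (sym j′≡j₀))
    ...   | tri> _ _ j₀<j′ = m-mono-≤ (ℕP.<⇒≤ j₀<j′)
    k<j₀ : k < j₀
    k<j₀ with ℕP.<-cmp k j₀
    ... | tri< k<j₀ _ _ = k<j₀
    ... | tri≈ _ refl _ = ⊥-elim (BoolP.not-¬ pivot (proj₁ free-j₀))
    ... | tri> _ _ j₀<k = ⊥-elim (ℕP.<⇒≱ (proj₂ free-j₀) (proj₂ (earlier j₀ j₀<k)))

  module PivotEnumeration (k : ℕ) = Enumeration (blocksAt k) (AllowedAt k)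
    (λ s 1≤s → ∈-blocksFor⁻ (s ≡ᵇ m k) (isEarlier k s) s 1≤s)
    (λ s 1≤s → ∈-blocksFor⁺ (s ≡ᵇ m k) (isEarlier k s) s 1≤s)
    (λ s → blocksFor-unique (s ≡ᵇ m k) (isEarlier k s) s)

  -- Sizes up to n + m k suffice: parts never exceed the weight n, and the pivot m k must be reached.
  withPivot : ℕ → ℕ → List (List Part)
  withPivot n k = PivotEnumeration.overpartitions k (n ℕ.+ m k) n

  ∈-withPivot⁻ : ∀ n k π → π ∈ withPivot n k → IsOverpartition π × weight π ≡ n × PivotAt k π
  ∈-withPivot⁻ n k π π∈ with PivotEnumeration.∈-overpartitions⁻ k (n ℕ.+ m k) n π π∈
  ... | overpartition , _ , weight≡n , allowed =
    overpartition , weight≡n , allowedUpTo⇒pivotAt k (n ℕ.+ m k) π (ℕP.m≤n+m (m k) n) allowed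

  ∈-withPivot⁺ : ∀ n k π → IsOverpartition π → weight π ≡ n → PivotAt k π → π ∈ withPivot n k
  ∈-withPivot⁺ n k π overpartition weight≡n pivotAt =
    PivotEnumeration.∈-overpartitions⁺ k (n ℕ.+ m k) n π
      (overpartition , All.map ≤bound (partsAtMost-weight π) , weight≡n ,
       pivotAt⇒allowedUpTo k (n ℕ.+ m k) π pivotAt)
    where
    ≤bound : ∀ {t} → t ≤ weight π → t ≤ n ℕ.+ m k
    ≤bound t≤w = ℕP.≤-trans t≤w (ℕP.≤-trans (ℕP.≤-reflexive weight≡n) (ℕP.m≤m+n n (m k)))

  withPivot-length : ∀ n k → lengthℤ (withPivot n k) ≡ ((minusqInf ⊛ invqInf) ⊛ term r A a k) n
  withPivot-length n k = begin
    lengthℤ (withPivot n k)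
      ≡⟨ PivotEnumeration.overpartitions-length k T n ⟩
    prodDown (λ s i → lengthℤ (blocksAt k s i)) T n
      ≡⟨ prodDown-cong T (λ s _ _ → blocksFor-length (s ≡ᵇ m k) (isEarlier k s) s) n ⟩
    prodDown (factorAt k) T n
      ≡⟨ prodDown-factorAt k T (ℕP.m≤n+m (m k) n) n ⟩
    shift (exponent r A a k) (truncated ⊛ invPoch A a k) n
      ≡⟨ ⊛-shift (exponent r A a k) truncated (invPoch A a k) n ⟨
    (truncated ⊛ term r A a k) n
      ≡⟨ ⊛-congUpTo {g = term r A a k} n (λ i i≤n → sym (untruncate i (ℕP.≤-trans i≤n (ℕP.m≤m+n n (m k)))))
                    (λ _ _ → refl) ⟩
    ((minusqInf ⊛ invqInf) ⊛ term r A a k) n ∎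
    where
    T : ℕ
    T = n ℕ.+ m k
    truncated : Series
    truncated = prodDown onePlus T ⊛ prodDown invOneMinus T
    untruncate : ∀ i → i ≤ T → (minusqInf ⊛ invqInf) i ≡ truncated i
    untruncate i i≤T = ⊛-congUpTo {minusqInf} {g = invqInf} i
      (λ j j≤i → prodFrom1≈prodDown onePlus onePlus-oneBelow T j (ℕP.≤-trans j≤i i≤T))
      (λ j j≤i → prodFrom1≈prodDown invOneMinus invOneMinus-oneBelow T j (ℕP.≤-trans j≤i i≤T))

  -- term k = O(q^{k+1}), so only k ≤ n contribute to the coefficient of qⁿ.
  rhs-by-pivot : ∀ n → rhs r A a n ≡ sumTo (λ k → ((minusqInf ⊛ invqInf) ⊛ term r A a k) n) n
  rhs-by-pivot n = begin
    sumTo (λ i → F i * sumTo (λ k → term r A a k (n ∸ i)) (n ∸ i)) n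
      ≡⟨ sumTo-cong n (λ i _ → cong (F i *_) (sym (sumTo-dropTrailingZeros _ (n ∸ i) n (ℕP.m∸n≤m n i)
           (λ k n∸i<k → shift-< (exponent r A a k) (invPoch A a k) (n ∸ i)
                          (ℕP.<-≤-trans (ℕP.<-trans n∸i<k (<m k)) (m≤exponent k)))))) ⟩
    sumTo (λ i → F i * sumTo (λ k → term r A a k (n ∸ i)) n) n
      ≡⟨ sumTo-cong n (λ i _ → sym (sumTo-*ˡ (F i) (λ k → term r A a k (n ∸ i)) n)) ⟩
    sumTo (λ i → sumTo (λ k → F i * term r A a k (n ∸ i)) n) n
      ≡⟨ sumTo-swap (λ i k → F i * term r A a k (n ∸ i)) n n ⟩
    sumTo (λ k → (F ⊛ term r A a k) n) n ∎
    where
    F : Series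
    F = minusqInf ⊛ invqInf

  counted : ℕ → List (List Part)
  counted n = concatUpTo (withPivot n) n

  counted-unique : ∀ n → Unique (counted n)
  counted-unique n = concatUpTo-unique (withPivot n) n (λ k → PivotEnumeration.overpartitions-unique k (n ℕ.+ m k) n)
    (λ {k} {k′} {π} π∈ π∈′ → pivotAt-unique {π = π} (proj₂ (proj₂ (∈-withPivot⁻ n k π π∈)))
                                            (proj₂ (proj₂ (∈-withPivot⁻ n k′ π π∈′))))

  ∈-counted⁻ : 2 ≤ r → ∀ n π → π ∈ counted n → IsOverpartition π × weight π ≡ n × Counted r A a π
  ∈-counted⁻ 2≤r n π π∈ with ∈-concatUpTo⁻ (withPivot n) n π∈
  ... | k , _ , π∈k with ∈-withPivot⁻ n k π π∈k
  ...   | overpartition , weight≡n , pivotAt = overpartition , weight≡n , pivotAt⇒counted 2≤r π k pivotAt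

  ∈-counted⁺ : ∀ n π → IsOverpartition π × weight π ≡ n × Counted r A a π → π ∈ counted n
  ∈-counted⁺ n π (overpartition , weight≡n , counted-π) with counted⇒pivotAt π overpartition counted-π
  ... | k , pivotAt = ∈-concatUpTo⁺ (withPivot n) n k k≤n (∈-withPivot⁺ n k π overpartition weight≡n pivotAt)
    where
    k≤n : k ≤ n
    k≤n = ℕP.<⇒≤ (ℕP.<-≤-trans (<m k)
            (subst (m k ≤_) weight≡n (∈⇒≤weight π (hasOverlined-∈⁻ (m k) π (proj₁ pivotAt)))))

  counted-length : ∀ n → lengthℤ (counted n) ≡ rhs r A a n
  counted-length n = begin
    lengthℤ (counted n)                                       ≡⟨ concatUpTo-length (withPivot n) n ⟩
    sumTo (λ k → lengthℤ (withPivot n k)) n                    ≡⟨ sumTo-cong n (λ k _ → withPivot-length n k) ⟩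
    sumTo (λ k → ((minusqInf ⊛ invqInf) ⊛ term r A a k) n) n   ≡⟨ rhs-by-pivot n ⟨
    rhs r A a n                                               ∎

corollary2p4 : (A a r : ℕ) → 1 ≤ a → a ≤ A → 2 ≤ r → (n : ℕ) →
    Σ (List (List Part)) (λ L →
    Unique L ×
    ((π : List Part) → (π ∈ L) ⇔ (IsOverpartition π × (weight π ≡ n) × Counted r A a π)) ×
    ((ℤ.+ length L) ≡ rhs r A a n))
corollary2p4 A a r 1≤a a≤A 2≤r n =
  counted n , counted-unique n , (λ π → mk⇔ (∈-counted⁻ 2≤r n π) (∈-counted⁺ n π)) , counted-length n
  where open Counting A a r 1≤a a≤A
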